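{- Let $m\geq 2$ and $j\geq 1$ be integers and $n=2m+1$. Let $T(n)$ be the triangular graph whose vertices are the 2-subsets of $\mathbb{Z}_n$, two distinct 2-subsets being adjacent iff they intersect. For $i=1,\ldots,m$ let $C_i=\{\{\ell,\ell+i\}:\ell\in\mathbb{Z}_n\}$. Then $\pi=\{C_1,\dots,C_m\}$ is an equitable partition of $T(n)$ with quotient matrix $2I+4(J-I)$, and there exists a directed strongly regular graph with parameter set $(N,K,T,\Lambda,M)$, where $N=m(2m+1)(jm+1)$, $K=jm(2m+1)+4m-2$, $T=j(2m+1)+4m-2$, $\Lambda=j(2m+1)+2m-1$, $M=j(2m+1)+4$.
   Context: A directed strongly regular graph (DSRG) with parameters $(n,k,t,\lambda,\mu)$ is a loopless digraph on $n$ vertices whose adjacency matrix $A$ satisfies $AJ=JA=kJ$ and $A^2=tI+\lambda A+\mu(J-I-A)$. A partition of the vertices of an undirected graph is equitable with quotient matrix $Q=(q_{i,l})$ if every vertex of $C_i$ has exactly $q_{i,l}$ neighbours in $C_l$. $I,J$ are the $m\times m$ identity and all-ones matrices. -}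

module Defs where

open import Data.Nat as ℕ using (ℕ; _+_; _*_; _∸_; _≤_)
open import Data.Nat.Properties using () renaming (_≟_ to _≟ℕ_)
open import Data.Nat.DivMod using (_%_; m%n<n)
open import Data.Fin using (Fin; toℕ; fromℕ<; zero; suc) renaming (_<_ to _<ᶠ_)
open import Data.Fin.Properties using (any?) renaming (_≟_ to _≟ᶠ_; _<?_ to _<ᶠ?_)
open import Data.Product using (Σ; ∃; ∃-syntax; _×_; _,_; proj₁; proj₂)
open import Data.Sum using (_⊎_)
open import Relation.Nullary using (¬_; Dec; yes; no)
open import Relation.Nullary.Decidable using (_×-dec_; _⊎-dec_; ¬?)
open import Relation.Binary.PropositionalEquality using (_≡_)

sumFin : ∀ {n} → (Fin n → ℕ) → ℕ
sumFin {ℕ.zero}  f = 0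
sumFin {ℕ.suc n} f = f zero + sumFin (λ i → f (suc i))

count : ∀ {n} (P : Fin n → Set) → (∀ x → Dec (P x)) → ℕ
count P P? = sumFin (λ x → ind (P? x))
  where
  ind : ∀ {A : Set} → Dec A → ℕ
  ind (yes _) = 1
  ind (no _)  = 0

count₂ : ∀ {n} (P : Fin n → Fin n → Set) → (∀ x y → Dec (P x y)) → ℕ
count₂ P P? = sumFin (λ c → count (P c) (P? c))

Mat : ℕ → Set
Mat n = Fin n → Fin n → ℕ

_⊗_ : ∀ {n} → Mat n → Mat n → Mat n
(A ⊗ B) i j = sumFin (λ k → A i k * B k j)

Jm : ∀ {n} → Mat n
Jm i j = 1

Im : ∀ {n} → Mat n
Im i j with i ≟ᶠ j
... | yes _ = 1
... | no  _ = 0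

-- Directed strongly regular graph with parameters (n,k,t,λ,μ):
-- A is the adjacency matrix of a loopless digraph (0/1 entries, zero
-- diagonal), AJ = JA = kJ and A² = tI + λA + μ(J − I − A), all
-- matrix equalities stated entrywise.  (For a 0/1 matrix with zero
-- diagonal, the truncated entries J − I − A are the true ones.)
record IsDSRG {n : ℕ} (A : Mat n) (k t lam mu : ℕ) : Set where
  field
    zeroOne  : ∀ i j → A i j ≡ 0 ⊎ A i j ≡ 1
    loopless : ∀ i → A i i ≡ 0
    AJ≡kJ    : ∀ i j → (A ⊗ Jm) i j ≡ k * Jm i j
    JA≡kJ    : ∀ i j → (Jm ⊗ A) i j ≡ k * Jm i j
    A²-eq    : ∀ i j → (A ⊗ A) i j
                 ≡ t * Im i j + lam * A i j + mu * (Jm i j ∸ Im i j ∸ A i j)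

ExistsDSRG : ℕ → ℕ → ℕ → ℕ → ℕ → Set
ExistsDSRG n k t lam mu = Σ (Mat n) (λ A → IsDSRG A k t lam mu)

-- The triangular graph T(n) on the 2-subsets of ℤ_n, n = suc k.
-- A 2-subset {a,b} is represented canonically by the pair (a , b)
-- with a < b (as elements 0..n-1).

_+ₙ_ : ∀ {k} → Fin (ℕ.suc k) → ℕ → Fin (ℕ.suc k)
_+ₙ_ {k} ℓ i = fromℕ< (m%n<n (toℕ ℓ + i) (ℕ.suc k))

IsVert : ∀ {n} → Fin n → Fin n → Set
IsVert a b = a <ᶠ b

SameSet : ∀ {n} → Fin n → Fin n → Fin n → Fin n → Set
SameSet a b x y = (a ≡ x × b ≡ y) ⊎ (a ≡ y × b ≡ x)

AdjT : ∀ {n} → Fin n → Fin n → Fin n → Fin n → Set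
AdjT a b c d = ¬ SameSet a b c d
             × ((a ≡ c ⊎ a ≡ d) ⊎ (b ≡ c ⊎ b ≡ d))

InC : ∀ {k} → ℕ → Fin (ℕ.suc k) → Fin (ℕ.suc k) → Set
InC i a b = ∃[ ℓ ] SameSet a b ℓ (ℓ +ₙ i)

sameSet? : ∀ {n} (a b x y : Fin n) → Dec (SameSet a b x y)
sameSet? a b x y = ((a ≟ᶠ x) ×-dec (b ≟ᶠ y)) ⊎-dec ((a ≟ᶠ y) ×-dec (b ≟ᶠ x))

adjT? : ∀ {n} (a b c d : Fin n) → Dec (AdjT a b c d)
adjT? a b c d = ¬? (sameSet? a b c d)
  ×-dec (((a ≟ᶠ c) ⊎-dec (a ≟ᶠ d)) ⊎-dec ((b ≟ᶠ c) ⊎-dec (b ≟ᶠ d)))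

inC? : ∀ {k} (i : ℕ) (a b : Fin (ℕ.suc k)) → Dec (InC i a b)
inC? i a b = any? (λ ℓ → sameSet? a b ℓ (ℓ +ₙ i))

nbrsIn : ∀ {k} → ℕ → Fin (ℕ.suc k) → Fin (ℕ.suc k) → ℕ
nbrsIn l a b =
  count₂ (λ c d → IsVert c d × (AdjT a b c d × InC l c d))
         (λ c d → (c <ᶠ? d) ×-dec (adjT? a b c d ×-dec inC? l c d))

-- the quotient matrix 2I + 4(J − I), indexed by i, l ∈ {1..m}
Qmat : ℕ → ℕ → ℕ
Qmat i l with i ≟ℕ l
... | yes _ = 2
... | no  _ = 4

IsEquitablePartitionT : ℕ → Set
IsEquitablePartitionT m =
    (∀ i → 1 ≤ i → i ≤ m → ∃[ a ] ∃[ b ] (IsVert {n} a b × InC i a b))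
  × (∀ (a b : Fin n) → IsVert a b → ∃[ i ] (1 ≤ i × i ≤ m × InC i a b))
  × (∀ (a b : Fin n) → IsVert a b → ∀ i i' → 1 ≤ i → i ≤ m → 1 ≤ i' → i' ≤ m
       → InC i a b → InC i' a b → i ≡ i')
  × (∀ i l → 1 ≤ i → i ≤ m → 1 ≤ l → l ≤ m →
       ∀ (a b : Fin n) → IsVert a b → InC i a b → nbrsIn l a b ≡ Qmat i l)
  where n = ℕ.suc (2 * m)

module Submission where

-- The DSRG comes from a general lifting construction (module Lift): given a
-- DSRG(v, k, t, λ, μ) B whose vertices are split into m cells of n vertices,
-- each vertex having a in-neighbours in its own cell and μ in every other cell,
-- with k + a = λ + n, and a colouring of the ordered pairs of distinct points
-- of Fin (jm + 1) by the cells in which every point receives j arrows of each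
-- colour, the digraph on Fin v × Fin (jm + 1) with (u , x) → (w , y) iff
-- "x = y and u → w" or "x ≠ y and w lies in the cell coloured (x , y)" is a
-- DSRG(v(jm + 1), k + jmn, t + jn, λ + jn, μ + jn).  It is applied to T(n),
-- shown to be an SRG(mn, 4m − 2, 2m − 1, 4) with the cells as required
-- (a = 2, μ = 4) via its point–edge incidence matrix N  (A + 2I = N Nᵀ,
-- Nᵀ N = (n − 2) I + J).

open import Defs
open import Data.Nat as ℕ using (ℕ; zero; suc; _+_; _*_; _∸_; _≤_; _<_; z≤n; s≤s; _≤?_)
open import Data.Nat.Properties
open import Data.Nat.DivMod using (_%_; m%n<n; %-distribˡ-+; m%n%n≡m%n; [m+n]%n≡m%n; m<n⇒m%n≡m)
open import Data.Nat.Tactic.RingSolver using (solve-∀)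
open import Data.Fin as F using (Fin; toℕ; fromℕ<; combine; remQuot; punchIn; punchOut)
open import Data.Fin.Properties as FP
  using (toℕ-injective; toℕ-fromℕ<; toℕ<n; remQuot-combine; combine-remQuot; punchInᵢ≢i; punchOut-cong; punchOut-punchIn)
open import Data.Product using (Σ; ∃-syntax; _×_; _,_; proj₁; proj₂; uncurry)
open import Data.Product.Properties using (≡-dec)
open import Data.Sum using (_⊎_; inj₁; inj₂) renaming (swap to ⊎-swap)
open import Data.Empty using (⊥-elim)
open import Function using (_∘_; _⇔_; mk⇔; Equivalence)
open import Relation.Nullary using (¬_; Dec; yes; no)
open import Relation.Nullary.Decidable using (_×-dec_; _⊎-dec_; ¬?)
open import Relation.Binary.PropositionalEquality
import Algebra.Properties.CommutativeMonoid.Sum as MonoidSum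
import Algebra.Properties.Semiring.Sum as SemiringSum

open ≡-Reasoning

module ΣL = MonoidSum +-0-commutativeMonoid
module ΣS = SemiringSum +-*-semiring

sumFin≡sum : ∀ {n} (f : Fin n → ℕ) → sumFin f ≡ ΣL.sum f
sumFin≡sum {zero}  f = refl
sumFin≡sum {suc n} f = cong (f F.zero +_) (sumFin≡sum (f ∘ F.suc))

sum-cong : ∀ {n} {f g : Fin n → ℕ} → (∀ i → f i ≡ g i) → sumFin f ≡ sumFin g
sum-cong {f = f} {g} f≗g =
  trans (sumFin≡sum f) (trans (ΣL.sum-cong-≗ f≗g) (sym (sumFin≡sum g)))

sum-+ : ∀ {n} (f g : Fin n → ℕ) → sumFin (λ i → f i + g i) ≡ sumFin f + sumFin g
sum-+ f g = begin
  sumFin (λ i → f i + g i)  ≡⟨ sumFin≡sum (λ i → f i + g i) ⟩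
  ΣL.sum (λ i → f i + g i)  ≡⟨ ΣL.∑-distrib-+ f g ⟩
  ΣL.sum f + ΣL.sum g       ≡⟨ sym (cong₂ _+_ (sumFin≡sum f) (sumFin≡sum g)) ⟩
  sumFin f + sumFin g       ∎

sum-*ˡ : ∀ {n} c (f : Fin n → ℕ) → sumFin (λ i → c * f i) ≡ c * sumFin f
sum-*ˡ c f = begin
  sumFin (λ i → c * f i)  ≡⟨ sumFin≡sum (λ i → c * f i) ⟩
  ΣL.sum (λ i → c * f i)  ≡⟨ sym (ΣS.*-distribˡ-sum c f) ⟩
  c * ΣL.sum f            ≡⟨ sym (cong (c *_) (sumFin≡sum f)) ⟩
  c * sumFin f            ∎

sum-*ʳ : ∀ {n} c (f : Fin n → ℕ) → sumFin (λ i → f i * c) ≡ sumFin f * c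
sum-*ʳ c f = trans (sum-cong (λ i → *-comm (f i) c)) (trans (sum-*ˡ c f) (*-comm c _))

sum-const : ∀ {n} c → sumFin {n} (λ _ → c) ≡ n * c
sum-const {zero}  c = refl
sum-const {suc n} c = cong (c +_) (sum-const {n} c)

sum-zero : ∀ {n} {f : Fin n → ℕ} → (∀ i → f i ≡ 0) → sumFin f ≡ 0
sum-zero {n} f≗0 = trans (sum-cong f≗0) (trans (sum-const {n} 0) (*-zeroʳ n))

sum-swap : ∀ {a b} (f : Fin a → Fin b → ℕ) →
           sumFin (λ i → sumFin (f i)) ≡ sumFin (λ j → sumFin (λ i → f i j))
sum-swap f = begin
  sumFin (λ i → sumFin (f i))                ≡⟨ sum-cong (λ i → sumFin≡sum (f i)) ⟩
  sumFin (λ i → ΣL.sum (f i))                ≡⟨ sumFin≡sum (λ i → ΣL.sum (f i)) ⟩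
  ΣL.sum (λ i → ΣL.sum (f i))                ≡⟨ ΣL.∑-comm f ⟩
  ΣL.sum (λ j → ΣL.sum (λ i → f i j))        ≡⟨ sym (sumFin≡sum (λ j → ΣL.sum (λ i → f i j))) ⟩
  sumFin (λ j → ΣL.sum (λ i → f i j))        ≡⟨ sum-cong (λ j → sym (sumFin≡sum (λ i → f i j))) ⟩
  sumFin (λ j → sumFin (λ i → f i j))        ∎

sum-punch : ∀ {n} (y : Fin (suc n)) (f : Fin (suc n) → ℕ) →
            sumFin f ≡ f y + sumFin (λ e → f (punchIn y e))
sum-punch y f = begin
  sumFin f                                    ≡⟨ sumFin≡sum f ⟩
  ΣL.sum f                                    ≡⟨ ΣL.sum-remove f ⟩
  f y + ΣL.sum (λ e → f (punchIn y e))        ≡⟨ cong (f y +_) (sym (sumFin≡sum (λ e → f (punchIn y e)))) ⟩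
  f y + sumFin (λ e → f (punchIn y e))        ∎

sum-product : ∀ {a b} (f : Fin a → ℕ) (g : Fin b → ℕ) →
              sumFin f * sumFin g ≡ sumFin (λ p → sumFin (λ q → f p * g q))
sum-product f g = trans (sym (sum-*ʳ (sumFin g) f)) (sum-cong (λ p → sym (sum-*ˡ (f p) g)))

sum-+₄ : ∀ {n} (f g h l : Fin n → ℕ) →
  sumFin (λ i → f i + g i + h i + l i) ≡ sumFin f + sumFin g + sumFin h + sumFin l
sum-+₄ f g h l = begin
  sumFin (λ i → f i + g i + h i + l i)            ≡⟨ sum-+ (λ i → f i + g i + h i) l ⟩
  sumFin (λ i → f i + g i + h i) + sumFin l       ≡⟨ cong (_+ sumFin l) (sum-+ (λ i → f i + g i) h) ⟩
  sumFin (λ i → f i + g i) + sumFin h + sumFin l  ≡⟨ cong (λ x → x + sumFin h + sumFin l) (sum-+ f g) ⟩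
  sumFin f + sumFin g + sumFin h + sumFin l       ∎

sum-expand : ∀ {n} (f g f' g' : Fin n → ℕ) →
  sumFin (λ i → (f i + g i) * (f' i + g' i))
  ≡ sumFin (λ i → f i * f' i) + sumFin (λ i → f i * g' i)
    + sumFin (λ i → g i * f' i) + sumFin (λ i → g i * g' i)
sum-expand f g f' g' =
  trans (sum-cong (λ i → expand (f i) (g i) (f' i) (g' i)))
        (sum-+₄ (λ i → f i * f' i) (λ i → f i * g' i) (λ i → g i * f' i) (λ i → g i * g' i))
  where
  expand : ∀ a b c d → (a + b) * (c + d) ≡ a * c + a * d + b * c + b * d
  expand = solve-∀

sum-split : ∀ {a b} (f : Fin (a + b) → ℕ) →
            sumFin f ≡ sumFin (λ i → f (i F.↑ˡ b)) + sumFin (λ i → f (a F.↑ʳ i))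
sum-split {zero}      f = refl
sum-split {suc a} {b} f =
  trans (cong (f F.zero +_) (sum-split {a} {b} (f ∘ F.suc))) (sym (+-assoc (f F.zero) _ _))

sum-combine : ∀ {a b} (f : Fin (a * b) → ℕ) →
              sumFin f ≡ sumFin (λ i → sumFin (λ j → f (combine {a} {b} i j)))
sum-combine {zero}      f = refl
sum-combine {suc a} {b} f =
  trans (sum-split {b} {a * b} f) (cong (sumFin (λ j → f (j F.↑ˡ a * b)) +_) (sum-combine {a} {b} (λ i → f (b F.↑ʳ i))))

sum-remQuot : ∀ {a b} (g : Fin a × Fin b → ℕ) →
              sumFin (g ∘ remQuot {a} b) ≡ sumFin (λ i → sumFin (λ j → g (i , j)))
sum-remQuot {a} {b} g =
  trans (sum-combine {a} {b} (g ∘ remQuot b))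
        (sum-cong (λ i → sum-cong (λ j → cong g (remQuot-combine i j))))

ind : ∀ {P : Set} → Dec P → ℕ
ind (yes _) = 1
ind (no _)  = 0

ind-≤1 : ∀ {P : Set} (p : Dec P) → ind p ≤ 1
ind-≤1 (yes _) = s≤s z≤n
ind-≤1 (no _)  = z≤n

ind-zeroOne : ∀ {P : Set} (p : Dec P) → ind p ≡ 0 ⊎ ind p ≡ 1
ind-zeroOne (yes _) = inj₂ refl
ind-zeroOne (no _)  = inj₁ refl

ind-no : ∀ {P : Set} (p : Dec P) → ¬ P → ind p ≡ 0
ind-no (yes x) ¬x = ⊥-elim (¬x x)
ind-no (no _)  _  = refl

ind-cong : ∀ {P Q : Set} (p : Dec P) (q : Dec Q) → P ⇔ Q → ind p ≡ ind q
ind-cong (yes _)  (yes _)  _   = refl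
ind-cong (no _)   (no _)   _   = refl
ind-cong (yes x)  (no ¬y)  P⇔Q = ⊥-elim (¬y (Equivalence.to P⇔Q x))
ind-cong (no ¬x)  (yes y)  P⇔Q = ⊥-elim (¬x (Equivalence.from P⇔Q y))

ind-× : ∀ {P Q : Set} (p : Dec P) (q : Dec Q) → ind (p ×-dec q) ≡ ind p * ind q
ind-× (yes _) (yes _) = refl
ind-× (yes _) (no _)  = refl
ind-× (no _)  _       = refl

ind-⊎ : ∀ {P Q : Set} (p : Dec P) (q : Dec Q) → ¬ (P × Q) → ind (p ⊎-dec q) ≡ ind p + ind q
ind-⊎ (yes x) (yes y) excl = ⊥-elim (excl (x , y))
ind-⊎ (yes _) (no _)  _    = refl
ind-⊎ (no _)  (yes _) _    = refl
ind-⊎ (no _)  (no _)  _    = refl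

count≡sum : ∀ {n} (P : Fin n → Set) (P? : ∀ x → Dec (P x)) →
            count P P? ≡ sumFin (λ x → ind (P? x))
count≡sum {zero}  P P? = refl
count≡sum {suc n} P P? with P? F.zero
... | yes _ = cong suc (count≡sum (P ∘ F.suc) (P? ∘ F.suc))
... | no _  = count≡sum (P ∘ F.suc) (P? ∘ F.suc)

δ : ∀ {n} → Fin n → Fin n → ℕ
δ a b = ind (a FP.≟ b)

δ-refl : ∀ {n} (a : Fin n) → δ a a ≡ 1
δ-refl a with a FP.≟ a
... | yes _  = refl
... | no a≢a = ⊥-elim (a≢a refl)

δ-≢ : ∀ {n} {a b : Fin n} → a ≢ b → δ a b ≡ 0
δ-≢ {a = a} {b} a≢b with a FP.≟ b
... | yes a≡b = ⊥-elim (a≢b a≡b)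
... | no _    = refl

δ-sym : ∀ {n} (a b : Fin n) → δ a b ≡ δ b a
δ-sym a b = ind-cong (a FP.≟ b) (b FP.≟ a) (mk⇔ sym sym)

δ-sift : ∀ {n} (a : Fin n) (f : Fin n → ℕ) → sumFin (λ p → δ p a * f p) ≡ f a
δ-sift {suc n} a f = begin
  sumFin (λ p → δ p a * f p)
    ≡⟨ sum-punch a (λ p → δ p a * f p) ⟩
  δ a a * f a + sumFin (λ e → δ (punchIn a e) a * f (punchIn a e))
    ≡⟨ cong₂ _+_ (cong (_* f a) (δ-refl a))
                 (sum-zero (λ e → cong (_* f (punchIn a e)) (δ-≢ (punchInᵢ≢i a e)))) ⟩
  1 * f a + 0
    ≡⟨ trans (+-identityʳ _) (*-identityˡ _) ⟩
  f a ∎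

δ-sift′ : ∀ {n} (a : Fin n) (f : Fin n → ℕ) → sumFin (λ p → δ a p * f p) ≡ f a
δ-sift′ a f = trans (sum-cong (λ p → cong (_* f p) (δ-sym a p))) (δ-sift a f)

δ-sum : ∀ {n} (a : Fin n) → sumFin (λ p → δ p a) ≡ 1
δ-sum a = trans (sum-cong (λ p → sym (*-identityʳ (δ p a)))) (δ-sift a (λ _ → 1))

δ-sum′ : ∀ {n} (a : Fin n) → sumFin (λ p → δ a p) ≡ 1
δ-sum′ a = trans (sum-cong (δ-sym a)) (δ-sum a)

δ-remQuot : ∀ {a b} (i k : Fin (a * b)) →
  δ i k ≡ δ (proj₁ (remQuot {a} b i)) (proj₁ (remQuot {a} b k))
          * δ (proj₂ (remQuot {a} b i)) (proj₂ (remQuot {a} b k))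
δ-remQuot {a} {b} i k with i FP.≟ k
... | yes refl = sym (cong₂ _*_ (δ-refl (proj₁ (remQuot {a} b i))) (δ-refl (proj₂ (remQuot {a} b i))))
... | no i≢k with proj₁ (remQuot {a} b i) FP.≟ proj₁ (remQuot {a} b k)
                | proj₂ (remQuot {a} b i) FP.≟ proj₂ (remQuot {a} b k)
...   | yes e₁ | yes e₂ = ⊥-elim (i≢k (begin
          i                                          ≡⟨ sym (combine-remQuot {a} b i) ⟩
          uncurry combine (remQuot {a} b i)          ≡⟨ cong₂ combine e₁ e₂ ⟩
          uncurry combine (remQuot {a} b k)          ≡⟨ combine-remQuot {a} b k ⟩
          k                                          ∎))
...   | yes _  | no _   = refl
...   | no _   | _      = refl

inFrom : ∀ {v m} → Mat v → (Fin v → Fin m) → Fin m → Fin v → ℕ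
inFrom B cell c w = sumFin (λ u → δ (cell u) c * B u w)

record InEquitable {v m} (B : Mat v) (cell : Fin v → Fin m) (n a b : ℕ) : Set where
  field
    cellSize    : ∀ c → sumFin (λ u → δ (cell u) c) ≡ n
    inOwnCell   : ∀ w → inFrom B cell (cell w) w ≡ a
    inOtherCell : ∀ c w → c ≢ cell w → inFrom B cell c w ≡ b

arrow : ∀ {s m} → (Fin s → Fin s → Fin m) → Fin s → Fin s → Fin m → ℕ
arrow colour x y c = (1 ∸ δ x y) * δ (colour x y) c

record BalancedColouring (s m j : ℕ) : Set where
  field
    colour   : Fin s → Fin s → Fin m
    balanced : ∀ y c → sumFin (λ x → arrow colour x y c) ≡ j

off+δ : ∀ {n} (x y : Fin n) → (1 ∸ δ x y) + δ x y ≡ 1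
off+δ x y = m∸n+n≡m (ind-≤1 (x FP.≟ y))

sum-off : ∀ {r} (x : Fin (suc r)) → sumFin (λ y → 1 ∸ δ x y) ≡ r
sum-off {r} x = begin
  sumFin (λ y → 1 ∸ δ x y)
    ≡⟨ sum-punch x (λ y → 1 ∸ δ x y) ⟩
  (1 ∸ δ x x) + sumFin (λ e → 1 ∸ δ x (punchIn x e))
    ≡⟨ cong₂ _+_ (cong (1 ∸_) (δ-refl x))
                 (sum-cong (λ e → cong (1 ∸_) (δ-≢ (punchInᵢ≢i x e ∘ sym)))) ⟩
  sumFin {r} (λ _ → 1)
    ≡⟨ trans (sum-const {r} 1) (*-identityʳ r) ⟩
  r ∎

dsrgRHS : ℕ → ℕ → ℕ → ℕ → ℕ → ℕ
dsrgRHS T L M I A = T * I + L * A + M * (1 ∸ I ∸ A)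

rhs-identity : ∀ T L M → dsrgRHS T L M 1 0 ≡ T
rhs-identity = identity
  where
  identity : ∀ T L M → T * 1 + L * 0 + M * 0 ≡ T
  identity = solve-∀

rhs-arc : ∀ T L M → dsrgRHS T L M 0 1 ≡ L
rhs-arc = arc
  where
  arc : ∀ T L M → T * 0 + L * 1 + M * 0 ≡ L
  arc = solve-∀

rhs-nonArc : ∀ T L M → dsrgRHS T L M 0 0 ≡ M
rhs-nonArc = nonArc
  where
  nonArc : ∀ T L M → T * 0 + L * 0 + M * 1 ≡ M
  nonArc = solve-∀

solveFor : ∀ {x a b} → x + a ≡ b → x ≡ b ∸ a
solveFor {x} {a} refl = sym (m+n∸n≡m x a)

shift-parameters : ∀ (I A t l μ c : ℕ) → I + A ≤ 1 →
  dsrgRHS t l μ I A + c ≡ dsrgRHS (t + c) (l + c) (μ + c) I A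
shift-parameters I A t l μ c I+A≤1 = begin
  t * I + l * A + μ * r + c                    ≡⟨ cong (t * I + l * A + μ * r +_) (sym (*-identityʳ c)) ⟩
  t * I + l * A + μ * r + c * 1                ≡⟨ cong (λ x → t * I + l * A + μ * r + c * x) (sym partition) ⟩
  t * I + l * A + μ * r + c * (I + A + r)      ≡⟨ distribute t l μ c I A r ⟩
  (t + c) * I + (l + c) * A + (μ + c) * r      ∎
  where
  r : ℕ
  r = 1 ∸ I ∸ A
  partition : I + A + r ≡ 1
  partition = trans (cong (I + A +_) (∸-+-assoc 1 I A)) (m+[n∸m]≡n I+A≤1)
  distribute : ∀ t l μ c I A r →
    t * I + l * A + μ * r + c * (I + A + r) ≡ (t + c) * I + (l + c) * A + (μ + c) * r
  distribute = solve-∀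

Im≡δ : ∀ {n} (i k : Fin n) → Im i k ≡ δ i k
Im≡δ i k with i FP.≟ k
... | yes _ = refl
... | no _  = refl

-- The vertex (u , x) is the copy of u in layer x.
module Lift {v m n j k t lam mu a : ℕ} {B : Mat v} {cell : Fin v → Fin m}
  (B-dsrg : IsDSRG B k t lam mu)
  (equitable : InEquitable B cell n a mu)
  (k+a≡λ+n : k + a ≡ lam + n)
  (C : BalancedColouring (suc (j * m)) m j)
  where

  open IsDSRG B-dsrg
  open InEquitable equitable
  open BalancedColouring C

  s : ℕ
  s = suc (j * m)

  arr : Fin s → Fin s → Fin m → ℕ
  arr = arrow colour

  lifted : Fin v × Fin s → Fin v × Fin s → ℕ
  lifted (u , x) (w , y) = δ x y * B u w + arr x y (cell w)

  liftedMat : Mat (v * s)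
  liftedMat i k = lifted (remQuot {v} s i) (remQuot {v} s k)

  K′ T′ L′ M′ : ℕ
  K′ = k + n * (j * m)
  T′ = t + n * j
  L′ = lam + n * j
  M′ = mu + n * j

  B-outDegree : ∀ u → sumFin (λ w → B u w) ≡ k
  B-outDegree u = begin
    sumFin (λ w → B u w)      ≡⟨ sum-cong (λ w → sym (*-identityʳ (B u w))) ⟩
    (B ⊗ Jm) u u              ≡⟨ AJ≡kJ u u ⟩
    k * 1                     ≡⟨ *-identityʳ k ⟩
    k                         ∎

  B-inDegree : ∀ w → sumFin (λ u → B u w) ≡ k
  B-inDegree w = begin
    sumFin (λ u → B u w)      ≡⟨ sum-cong (λ u → sym (*-identityˡ (B u w))) ⟩
    (Jm ⊗ B) w w              ≡⟨ JA≡kJ w w ⟩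
    k * 1                     ≡⟨ *-identityʳ k ⟩
    k                         ∎

  identity+adjacency≤1 : ∀ u w → δ u w + B u w ≤ 1
  identity+adjacency≤1 u w with u FP.≟ w
  ... | yes refl = ≤-reflexive (cong suc (loopless u))
  ... | no _ with zeroOne u w
  ...   | inj₁ B≡0 = ≤-trans (≤-reflexive B≡0) z≤n
  ...   | inj₂ B≡1 = ≤-reflexive B≡1

  vertexCount : v ≡ m * n
  vertexCount = begin
    v                                            ≡⟨ sym (*-identityʳ v) ⟩
    v * 1                                        ≡⟨ sym (sum-const {v} 1) ⟩
    sumFin {v} (λ _ → 1)                         ≡⟨ sum-cong (λ u → sym (δ-sum′ (cell u))) ⟩
    sumFin (λ u → sumFin (λ c → δ (cell u) c))   ≡⟨ sum-swap (λ u c → δ (cell u) c) ⟩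
    sumFin (λ c → sumFin (λ u → δ (cell u) c))   ≡⟨ sum-cong cellSize ⟩
    sumFin {m} (λ _ → n)                         ≡⟨ sum-const {m} n ⟩
    m * n                                        ∎

  arr-diag : ∀ x c → arr x x c ≡ 0
  arr-diag x c = cong (λ d → (1 ∸ d) * δ (colour x x) c) (δ-refl x)

  arr-off : ∀ {x y} → x ≢ y → ∀ c → arr x y c ≡ δ (colour x y) c
  arr-off {x} {y} x≢y c = trans (cong (λ d → (1 ∸ d) * δ (colour x y) c) (δ-≢ x≢y)) (+-identityʳ _)

  arrowTargets : ∀ x y → sumFin (λ u → arr x y (cell u)) ≡ n * (1 ∸ δ x y)
  arrowTargets x y = begin
    sumFin (λ u → (1 ∸ δ x y) * δ (colour x y) (cell u))  ≡⟨ sum-*ˡ (1 ∸ δ x y) (λ u → δ (colour x y) (cell u)) ⟩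
    (1 ∸ δ x y) * sumFin (λ u → δ (colour x y) (cell u))  ≡⟨ cong ((1 ∸ δ x y) *_) sizeOfColour ⟩
    (1 ∸ δ x y) * n                                       ≡⟨ *-comm (1 ∸ δ x y) n ⟩
    n * (1 ∸ δ x y)                                       ∎
    where
    sizeOfColour : sumFin (λ u → δ (colour x y) (cell u)) ≡ n
    sizeOfColour = trans (sum-cong (λ u → δ-sym (colour x y) (cell u))) (cellSize (colour x y))

  -- every x has jm arrows leaving it, each pointing into n vertices
  outDegree : ∀ u x → sumFin (λ w → sumFin (λ y → lifted (u , x) (w , y))) ≡ K′
  outDegree u x = begin
    sumFin (λ w → sumFin (λ y → δ x y * B u w + arr x y (cell w)))
      ≡⟨ sum-cong (λ w → sum-+ (λ y → δ x y * B u w) (λ y → arr x y (cell w))) ⟩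
    sumFin (λ w → sumFin (λ y → δ x y * B u w) + sumFin (λ y → arr x y (cell w)))
      ≡⟨ sum-+ (λ w → sumFin (λ y → δ x y * B u w)) (λ w → sumFin (λ y → arr x y (cell w))) ⟩
    sumFin (λ w → sumFin (λ y → δ x y * B u w)) + sumFin (λ w → sumFin (λ y → arr x y (cell w)))
      ≡⟨ cong₂ _+_ (sum-cong (λ w → trans (sum-*ʳ (B u w) (δ x)) (cong (_* B u w) (δ-sum′ x))))
                   (sum-swap (λ w y → arr x y (cell w))) ⟩
    sumFin (λ w → 1 * B u w) + sumFin (λ y → sumFin (λ w → arr x y (cell w)))
      ≡⟨ cong₂ _+_ (trans (sum-cong (λ w → *-identityˡ (B u w))) (B-outDegree u))
                   (sum-cong (arrowTargets x)) ⟩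
    k + sumFin (λ y → n * (1 ∸ δ x y))
      ≡⟨ cong (k +_) (trans (sum-*ˡ n (λ y → 1 ∸ δ x y)) (cong (n *_) (sum-off x))) ⟩
    k + n * (j * m) ∎

  -- every y receives j arrows of each colour, each from all v vertices
  inDegree : ∀ w y → sumFin (λ u → sumFin (λ x → lifted (u , x) (w , y))) ≡ K′
  inDegree w y = begin
    sumFin (λ u → sumFin (λ x → δ x y * B u w + arr x y (cell w)))
      ≡⟨ sum-cong {v} (λ u → sum-+ (λ x → δ x y * B u w) (λ x → arr x y (cell w))) ⟩
    sumFin (λ u → sumFin (λ x → δ x y * B u w) + sumFin (λ x → arr x y (cell w)))
      ≡⟨ sum-+ {v} (λ u → sumFin (λ x → δ x y * B u w)) (λ u → sumFin (λ x → arr x y (cell w))) ⟩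
    sumFin (λ u → sumFin (λ x → δ x y * B u w)) + sumFin {v} (λ u → sumFin (λ x → arr x y (cell w)))
      ≡⟨ cong₂ _+_ (sum-cong (λ u → trans (sum-*ʳ (B u w) (λ x → δ x y)) (cong (_* B u w) (δ-sum y))))
                   (sum-cong {v} (λ u → balanced y (cell w))) ⟩
    sumFin (λ u → 1 * B u w) + sumFin {v} (λ _ → j)
      ≡⟨ cong₂ _+_ (trans (sum-cong (λ u → *-identityˡ (B u w))) (B-inDegree w)) (sum-const {v} j) ⟩
    k + v * j
      ≡⟨ cong (λ v′ → k + v′ * j) vertexCount ⟩
    k + m * n * j
      ≡⟨ cong (k +_) (reorder m n j) ⟩
    k + n * (j * m) ∎
    where
    reorder : ∀ m n j → m * n * j ≡ n * (j * m)
    reorder = solve-∀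

  -- number of paths x → z → y through the other layers, counted with the
  -- n vertices of the middle cell
  twoStep : Fin s → Fin s → Fin m → ℕ
  twoStep x y c = sumFin (λ z → n * (1 ∸ δ x z) * arr z y c)

  -- together with the direct arrow these are the j arrows of colour c into
  -- y, each counted with the n vertices of its middle cell
  twoStep+direct : ∀ x y c → twoStep x y c + n * arr x y c ≡ n * j
  twoStep+direct x y c = begin
    twoStep x y c + n * arr x y c
      ≡⟨ cong (twoStep x y c +_) (sym (δ-sift′ x (λ z → n * arr z y c))) ⟩
    twoStep x y c + sumFin (λ z → δ x z * (n * arr z y c))
      ≡⟨ sym (sum-+ (λ z → n * (1 ∸ δ x z) * arr z y c) (λ z → δ x z * (n * arr z y c))) ⟩
    sumFin (λ z → n * (1 ∸ δ x z) * arr z y c + δ x z * (n * arr z y c))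
      ≡⟨ sum-cong (λ z → trans (regroup n (1 ∸ δ x z) (δ x z) (arr z y c))
                               (cong (λ e → n * e) (trans (cong (_* arr z y c) (off+δ x z)) (*-identityˡ _)))) ⟩
    sumFin (λ z → n * arr z y c)
      ≡⟨ trans (sum-*ˡ n (λ z → arr z y c)) (cong (n *_) (balanced y c)) ⟩
    n * j ∎
    where
    regroup : ∀ n o d a → n * o * a + d * (n * a) ≡ n * ((o + d) * a)
    regroup = solve-∀

  -- A walk (u , x) → (u′ , z) → (w , y) of the lifted digraph uses each of
  -- its two steps either inside a layer (δ-term) or along an arrow; the four
  -- kinds of walks are counted separately.

  walksInLayer : ∀ u (x : Fin s) w y →
    sumFin (λ u′ → sumFin (λ z → (δ x z * B u u′) * (δ z y * B u′ w))) ≡ δ x y * (B ⊗ B) u w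
  walksInLayer u x w y =
    trans (sum-cong (λ u′ → trans (sum-cong (λ z → regroup (δ x z) (B u u′) (δ z y) (B u′ w)))
                                  (δ-sift′ x (λ z → δ z y * (B u u′ * B u′ w)))))
          (sum-*ˡ (δ x y) (λ u′ → B u u′ * B u′ w))
    where
    regroup : ∀ a b c d → (a * b) * (c * d) ≡ a * (c * (b * d))
    regroup = solve-∀

  -- a step of B followed by the arrow (x , y): k choices of the middle vertex
  walksOutThenArrow : ∀ u x w (y : Fin s) →
    sumFin (λ u′ → sumFin (λ z → (δ x z * B u u′) * arr z y (cell w))) ≡ k * arr x y (cell w)
  walksOutThenArrow u x w y =
    trans (sum-cong (λ u′ → trans (sum-cong (λ z → *-assoc (δ x z) (B u u′) (arr z y (cell w))))
                                  (δ-sift′ x (λ z → B u u′ * arr z y (cell w)))))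
          (trans (sum-*ʳ (arr x y (cell w)) (B u)) (cong (_* arr x y (cell w)) (B-outDegree u)))

  walksArrowThenIn : ∀ x w y →
    sumFin (λ u′ → sumFin (λ z → arr x z (cell u′) * (δ z y * B u′ w)))
    ≡ (1 ∸ δ x y) * inFrom B cell (colour x y) w
  walksArrowThenIn x w y = begin
    sumFin (λ u′ → sumFin (λ z → arr x z (cell u′) * (δ z y * B u′ w)))
      ≡⟨ sum-cong (λ u′ → trans (sum-cong (λ z → regroup (arr x z (cell u′)) (δ z y) (B u′ w)))
                                (δ-sift y (λ z → arr x z (cell u′) * B u′ w))) ⟩
    sumFin (λ u′ → (1 ∸ δ x y) * δ (colour x y) (cell u′) * B u′ w)
      ≡⟨ sum-cong (λ u′ → trans (*-assoc (1 ∸ δ x y) (δ (colour x y) (cell u′)) (B u′ w))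
                                (cong (λ e → (1 ∸ δ x y) * (e * B u′ w)) (δ-sym (colour x y) (cell u′)))) ⟩
    sumFin (λ u′ → (1 ∸ δ x y) * (δ (cell u′) (colour x y) * B u′ w))
      ≡⟨ sum-*ˡ (1 ∸ δ x y) (λ u′ → δ (cell u′) (colour x y) * B u′ w) ⟩
    (1 ∸ δ x y) * inFrom B cell (colour x y) w ∎
    where
    regroup : ∀ a b c → a * (b * c) ≡ b * (a * c)
    regroup = solve-∀

  walksTwoArrows : ∀ x w y →
    sumFin (λ u′ → sumFin (λ z → arr x z (cell u′) * arr z y (cell w))) ≡ twoStep x y (cell w)
  walksTwoArrows x w y = begin
    sumFin (λ u′ → sumFin (λ z → arr x z (cell u′) * arr z y (cell w)))
      ≡⟨ sum-swap (λ u′ z → arr x z (cell u′) * arr z y (cell w)) ⟩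
    sumFin (λ z → sumFin (λ u′ → arr x z (cell u′) * arr z y (cell w)))
      ≡⟨ sum-cong (λ z → trans (sum-*ʳ (arr z y (cell w)) (λ u′ → arr x z (cell u′)))
                               (cong (_* arr z y (cell w)) (arrowTargets x z))) ⟩
    twoStep x y (cell w) ∎

  twoWalks : Fin v → Fin s → Fin v → Fin s → ℕ
  twoWalks u x w y = sumFin (λ u′ → sumFin (λ z → lifted (u , x) (u′ , z) * lifted (u′ , z) (w , y)))

  square : ∀ u x w y → twoWalks u x w y
    ≡ δ x y * (B ⊗ B) u w + k * arr x y (cell w)
      + (1 ∸ δ x y) * inFrom B cell (colour x y) w + twoStep x y (cell w)
  square u x w y = begin
    sumFin (λ u′ → sumFin (λ z → (inB u′ z + viaArrow u′ z) * (outB u′ z + arr z y (cell w))))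
      ≡⟨ sum-cong (λ u′ → sum-expand (inB u′) (viaArrow u′) (outB u′) (λ z → arr z y (cell w))) ⟩
    sumFin (λ u′ → W₁ u′ + W₂ u′ + W₃ u′ + W₄ u′)
      ≡⟨ sum-+₄ W₁ W₂ W₃ W₄ ⟩
    sumFin W₁ + sumFin W₂ + sumFin W₃ + sumFin W₄
      ≡⟨ cong₂ _+_ (cong₂ _+_ (cong₂ _+_ (walksInLayer u x w y) (walksOutThenArrow u x w y))
                              (walksArrowThenIn x w y))
                   (walksTwoArrows x w y) ⟩
    δ x y * (B ⊗ B) u w + k * arr x y (cell w)
      + (1 ∸ δ x y) * inFrom B cell (colour x y) w + twoStep x y (cell w) ∎
    where
    inB viaArrow outB : Fin v → Fin s → ℕ
    inB u′ z = δ x z * B u u′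
    viaArrow u′ z = arr x z (cell u′)
    outB u′ z = δ z y * B u′ w
    W₁ W₂ W₃ W₄ : Fin v → ℕ
    W₁ u′ = sumFin (λ z → inB u′ z * outB u′ z)
    W₂ u′ = sumFin (λ z → inB u′ z * arr z y (cell w))
    W₃ u′ = sumFin (λ z → viaArrow u′ z * outB u′ z)
    W₄ u′ = sumFin (λ z → viaArrow u′ z * arr z y (cell w))

  liftedInLayer : ∀ u x w → lifted (u , x) (w , x) ≡ B u w
  liftedInLayer u x w = begin
    δ x x * B u w + arr x x (cell w)   ≡⟨ cong₂ _+_ (cong (_* B u w) (δ-refl x)) (arr-diag x (cell w)) ⟩
    1 * B u w + 0                      ≡⟨ trans (+-identityʳ _) (*-identityˡ _) ⟩
    B u w                              ∎

  liftedAcross : ∀ {x y : Fin s} → x ≢ y → ∀ u w → lifted (u , x) (w , y) ≡ arr x y (cell w)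
  liftedAcross {x} {y} x≢y u w = cong (λ d → d * B u w + arr x y (cell w)) (δ-≢ x≢y)

  offLayer : ∀ {x y : Fin s} → x ≢ y → ∀ (u w : Fin v) → δ u w * δ x y ≡ 0
  offLayer x≢y u w = trans (cong (δ u w *_) (δ-≢ x≢y)) (*-zeroʳ (δ u w))

  -- The value of the four-term expansion of 'square' in the three cases.
  -- x = y: walks stay in the layer x, plus the nj walks through other layers
  expansionInLayer : ∀ {D A F W : ℕ} (B² : ℕ) → D ≡ 1 → A ≡ 0 → W + n * A ≡ n * j →
                     D * B² + k * A + (1 ∸ D) * F + W ≡ B² + n * j
  expansionInLayer {W = W} B² refl refl W≡nj = begin
    1 * B² + k * 0 + 0 + W   ≡⟨ regroup B² k W n ⟩
    B² + (W + n * 0)         ≡⟨ cong (B² +_) W≡nj ⟩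
    B² + n * j               ∎
    where
    regroup : ∀ B² k W n → 1 * B² + k * 0 + 0 + W ≡ B² + (W + n * 0)
    regroup = solve-∀

  -- x ≠ y and w in the cell coloured (x , y): an arc, and k + a = λ + n
  expansionArc : ∀ {D A F W : ℕ} (B² : ℕ) → D ≡ 0 → A ≡ 1 → F ≡ a → W + n * A ≡ n * j →
                 D * B² + k * A + (1 ∸ D) * F + W ≡ L′
  expansionArc {W = W} B² refl refl refl W+n≡nj = begin
    k * 1 + (a + 0) + W    ≡⟨ regroup k a W ⟩
    (k + a) + W            ≡⟨ cong (_+ W) k+a≡λ+n ⟩
    (lam + n) + W          ≡⟨ regroup′ lam n W ⟩
    lam + (W + n * 1)      ≡⟨ cong (lam +_) W+n≡nj ⟩
    lam + n * j            ∎
    where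
    regroup : ∀ k a W → k * 1 + (a + 0) + W ≡ (k + a) + W
    regroup = solve-∀
    regroup′ : ∀ l n W → (l + n) + W ≡ l + (W + n * 1)
    regroup′ = solve-∀

  -- x ≠ y and w outside the cell coloured (x , y): no arc, and b = μ
  expansionNonArc : ∀ {D A F W : ℕ} (B² : ℕ) → D ≡ 0 → A ≡ 0 → F ≡ mu → W + n * A ≡ n * j →
                    D * B² + k * A + (1 ∸ D) * F + W ≡ M′
  expansionNonArc {W = W} B² refl refl refl W≡nj = begin
    k * 0 + (mu + 0) + W   ≡⟨ regroup k mu W n ⟩
    mu + (W + n * 0)       ≡⟨ cong (mu +_) W≡nj ⟩
    mu + n * j             ∎
    where
    regroup : ∀ k mu W n → k * 0 + (mu + 0) + W ≡ mu + (W + n * 0)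
    regroup = solve-∀

  squareInLayer : ∀ u x w → twoWalks u x w x ≡ dsrgRHS T′ L′ M′ (δ u w * δ x x) (lifted (u , x) (w , x))
  squareInLayer u x w = begin
    twoWalks u x w x
      ≡⟨ square u x w x ⟩
    δ x x * (B ⊗ B) u w + k * arr x x (cell w)
      + (1 ∸ δ x x) * inFrom B cell (colour x x) w + twoStep x x (cell w)
      ≡⟨ expansionInLayer ((B ⊗ B) u w) (δ-refl x) (arr-diag x (cell w)) (twoStep+direct x x (cell w)) ⟩
    (B ⊗ B) u w + n * j
      ≡⟨ cong (_+ n * j) (trans (A²-eq u w) (cong (λ I → dsrgRHS t lam mu I (B u w)) (Im≡δ u w))) ⟩
    dsrgRHS t lam mu (δ u w) (B u w) + n * j
      ≡⟨ shift-parameters (δ u w) (B u w) t lam mu (n * j) (identity+adjacency≤1 u w) ⟩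
    dsrgRHS T′ L′ M′ (δ u w) (B u w)
      ≡⟨ cong₂ (dsrgRHS T′ L′ M′) (sym (trans (cong (δ u w *_) (δ-refl x)) (*-identityʳ _)))
                                   (sym (liftedInLayer u x w)) ⟩
    dsrgRHS T′ L′ M′ (δ u w * δ x x) (lifted (u , x) (w , x)) ∎

  squareArc : ∀ {x y} u w → x ≢ y → colour x y ≡ cell w →
              twoWalks u x w y ≡ dsrgRHS T′ L′ M′ (δ u w * δ x y) (lifted (u , x) (w , y))
  squareArc {x} {y} u w x≢y colour≡cell = begin
    twoWalks u x w y
      ≡⟨ square u x w y ⟩
    δ x y * (B ⊗ B) u w + k * arr x y (cell w)
      + (1 ∸ δ x y) * inFrom B cell (colour x y) w + twoStep x y (cell w)
      ≡⟨ expansionArc ((B ⊗ B) u w) (δ-≢ x≢y) arc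
                      (trans (cong (λ c → inFrom B cell c w) colour≡cell) (inOwnCell w))
                      (twoStep+direct x y (cell w)) ⟩
    L′
      ≡⟨ sym (rhs-arc T′ L′ M′) ⟩
    dsrgRHS T′ L′ M′ 0 1
      ≡⟨ cong₂ (dsrgRHS T′ L′ M′) (sym (offLayer x≢y u w)) (sym (trans (liftedAcross x≢y u w) arc)) ⟩
    dsrgRHS T′ L′ M′ (δ u w * δ x y) (lifted (u , x) (w , y)) ∎
    where
    arc : arr x y (cell w) ≡ 1
    arc = trans (arr-off x≢y (cell w)) (trans (cong (λ c → δ c (cell w)) colour≡cell) (δ-refl (cell w)))

  squareNonArc : ∀ {x y} u w → x ≢ y → colour x y ≢ cell w →
                 twoWalks u x w y ≡ dsrgRHS T′ L′ M′ (δ u w * δ x y) (lifted (u , x) (w , y))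
  squareNonArc {x} {y} u w x≢y colour≢cell = begin
    twoWalks u x w y
      ≡⟨ square u x w y ⟩
    δ x y * (B ⊗ B) u w + k * arr x y (cell w)
      + (1 ∸ δ x y) * inFrom B cell (colour x y) w + twoStep x y (cell w)
      ≡⟨ expansionNonArc ((B ⊗ B) u w) (δ-≢ x≢y) nonArc (inOtherCell (colour x y) w colour≢cell)
                         (twoStep+direct x y (cell w)) ⟩
    M′
      ≡⟨ sym (rhs-nonArc T′ L′ M′) ⟩
    dsrgRHS T′ L′ M′ 0 0
      ≡⟨ cong₂ (dsrgRHS T′ L′ M′) (sym (offLayer x≢y u w)) (sym (trans (liftedAcross x≢y u w) nonArc)) ⟩
    dsrgRHS T′ L′ M′ (δ u w * δ x y) (lifted (u , x) (w , y)) ∎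
    where
    nonArc : arr x y (cell w) ≡ 0
    nonArc = trans (arr-off x≢y (cell w)) (δ-≢ colour≢cell)

  squareEquation : ∀ u x w y →
    twoWalks u x w y ≡ dsrgRHS T′ L′ M′ (δ u w * δ x y) (lifted (u , x) (w , y))
  squareEquation u x w y = byLayer (x FP.≟ y)
    where
    byLayer : Dec (x ≡ y) → twoWalks u x w y ≡ dsrgRHS T′ L′ M′ (δ u w * δ x y) (lifted (u , x) (w , y))
    byLayer (yes refl) = squareInLayer u x w
    byLayer (no x≢y)   = byColour (colour x y FP.≟ cell w)
      where
      byColour : Dec (colour x y ≡ cell w) →
                 twoWalks u x w y ≡ dsrgRHS T′ L′ M′ (δ u w * δ x y) (lifted (u , x) (w , y))
      byColour (yes colour≡cell) = squareArc u w x≢y colour≡cell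
      byColour (no colour≢cell)  = squareNonArc u w x≢y colour≢cell

  Im≡pairδ : ∀ i l → Im i l ≡ δ (proj₁ (remQuot {v} s i)) (proj₁ (remQuot {v} s l))
                              * δ (proj₂ (remQuot {v} s i)) (proj₂ (remQuot {v} s l))
  Im≡pairδ i l = trans (Im≡δ i l) (δ-remQuot {v} {s} i l)

  liftedZeroOne : ∀ p q → lifted p q ≡ 0 ⊎ lifted p q ≡ 1
  liftedZeroOne (u , x) (w , y) = byLayer (x FP.≟ y)
    where
    byLayer : Dec (x ≡ y) → lifted (u , x) (w , y) ≡ 0 ⊎ lifted (u , x) (w , y) ≡ 1
    byLayer (yes refl) = subst (λ e → e ≡ 0 ⊎ e ≡ 1) (sym (liftedInLayer u x w)) (zeroOne u w)
    byLayer (no x≢y)   = subst (λ e → e ≡ 0 ⊎ e ≡ 1)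
                               (sym (trans (liftedAcross x≢y u w) (arr-off x≢y (cell w))))
                               (ind-zeroOne (colour x y FP.≟ cell w))

  isDSRG : IsDSRG liftedMat K′ T′ L′ M′
  isDSRG = record
    { zeroOne  = λ i l → liftedZeroOne (remQuot {v} s i) (remQuot {v} s l)
    ; loopless = λ i → trans (liftedInLayer (vertex i) (layer i) (vertex i)) (loopless (vertex i))
    ; AJ≡kJ    = λ i l → begin
        sumFin (λ i′ → liftedMat i i′ * 1)               ≡⟨ sum-cong (λ i′ → *-identityʳ (liftedMat i i′)) ⟩
        sumFin (λ i′ → liftedMat i i′)                   ≡⟨ sum-remQuot (lifted (remQuot {v} s i)) ⟩
        sumFin (λ w → sumFin (λ y → lifted (remQuot {v} s i) (w , y)))
                                                         ≡⟨ outDegree (vertex i) (layer i) ⟩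
        K′                                               ≡⟨ sym (*-identityʳ K′) ⟩
        K′ * 1                                           ∎
    ; JA≡kJ    = λ i l → begin
        sumFin (λ i′ → 1 * liftedMat i′ l)               ≡⟨ sum-cong (λ i′ → *-identityˡ (liftedMat i′ l)) ⟩
        sumFin (λ i′ → liftedMat i′ l)                   ≡⟨ sum-remQuot (λ p → lifted p (remQuot {v} s l)) ⟩
        sumFin (λ u → sumFin (λ x → lifted (u , x) (remQuot {v} s l)))
                                                         ≡⟨ inDegree (vertex l) (layer l) ⟩
        K′                                               ≡⟨ sym (*-identityʳ K′) ⟩
        K′ * 1                                           ∎
    ; A²-eq    = λ i l → begin
        (liftedMat ⊗ liftedMat) i l
          ≡⟨ sum-remQuot (λ p → lifted (remQuot {v} s i) p * lifted p (remQuot {v} s l)) ⟩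
        twoWalks (vertex i) (layer i) (vertex l) (layer l)
          ≡⟨ squareEquation (vertex i) (layer i) (vertex l) (layer l) ⟩
        dsrgRHS T′ L′ M′ (δ (vertex i) (vertex l) * δ (layer i) (layer l)) (liftedMat i l)
          ≡⟨ cong (λ I → dsrgRHS T′ L′ M′ I (liftedMat i l)) (sym (Im≡pairδ i l)) ⟩
        dsrgRHS T′ L′ M′ (Im i l) (liftedMat i l) ∎
    }
    where
    vertex : Fin (v * s) → Fin v
    vertex i = proj₁ (remQuot {v} s i)
    layer : Fin (v * s) → Fin s
    layer i = proj₂ (remQuot {v} s i)

-- Arithmetic in ℤ_n, n = suc k, with the addition _+ₙ_ of Defs, and the
-- cyclic distance  dist ℓ p = (p − ℓ) mod n.
module Cyclic {k : ℕ} where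

  private
    n : ℕ
    n = suc k

  toℕ-+ₙ : ∀ (ℓ : Fin n) i → toℕ (ℓ +ₙ i) ≡ (toℕ ℓ + i) % n
  toℕ-+ₙ ℓ i = toℕ-fromℕ< (m%n<n (toℕ ℓ + i) n)

  %-absorbˡ : ∀ x y → (x % n + y) % n ≡ (x + y) % n
  %-absorbˡ x y = begin
    (x % n + y) % n            ≡⟨ %-distribˡ-+ (x % n) y n ⟩
    (x % n % n + y % n) % n    ≡⟨ cong (λ r → (r + y % n) % n) (m%n%n≡m%n x n) ⟩
    (x % n + y % n) % n        ≡⟨ sym (%-distribˡ-+ x y n) ⟩
    (x + y) % n                ∎

  toℕ%n : (ℓ : Fin n) → toℕ ℓ % n ≡ toℕ ℓ
  toℕ%n ℓ = m<n⇒m%n≡m (toℕ<n ℓ)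

  +ₙ-assoc : (ℓ : Fin n) (a b : ℕ) → (ℓ +ₙ a) +ₙ b ≡ ℓ +ₙ (a + b)
  +ₙ-assoc ℓ a b = toℕ-injective (begin
    toℕ ((ℓ +ₙ a) +ₙ b)          ≡⟨ toℕ-+ₙ (ℓ +ₙ a) b ⟩
    (toℕ (ℓ +ₙ a) + b) % n       ≡⟨ cong (λ r → (r + b) % n) (toℕ-+ₙ ℓ a) ⟩
    ((toℕ ℓ + a) % n + b) % n    ≡⟨ %-absorbˡ (toℕ ℓ + a) b ⟩
    (toℕ ℓ + a + b) % n          ≡⟨ cong (_% n) (+-assoc (toℕ ℓ) a b) ⟩
    (toℕ ℓ + (a + b)) % n        ≡⟨ sym (toℕ-+ₙ ℓ (a + b)) ⟩
    toℕ (ℓ +ₙ (a + b))           ∎)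

  +ₙ-zero : (ℓ : Fin n) → ℓ +ₙ 0 ≡ ℓ
  +ₙ-zero ℓ = toℕ-injective (trans (toℕ-+ₙ ℓ 0) (trans (cong (_% n) (+-identityʳ (toℕ ℓ))) (toℕ%n ℓ)))

  +ₙ-period : (ℓ : Fin n) → ℓ +ₙ n ≡ ℓ
  +ₙ-period ℓ = toℕ-injective (trans (toℕ-+ₙ ℓ n) (trans ([m+n]%n≡m%n (toℕ ℓ) n) (toℕ%n ℓ)))

  +ₙ-transpose : ∀ {o} (ℓ p : Fin n) → o ≤ n → ℓ +ₙ o ≡ p → ℓ ≡ p +ₙ (n ∸ o)
  +ₙ-transpose {o} ℓ p o≤n ℓ+o≡p = begin
    ℓ                        ≡⟨ sym (+ₙ-period ℓ) ⟩
    ℓ +ₙ n                   ≡⟨ cong (ℓ +ₙ_) (sym (m+[n∸m]≡n o≤n)) ⟩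
    ℓ +ₙ (o + (n ∸ o))       ≡⟨ sym (+ₙ-assoc ℓ o (n ∸ o)) ⟩
    (ℓ +ₙ o) +ₙ (n ∸ o)      ≡⟨ cong (_+ₙ (n ∸ o)) ℓ+o≡p ⟩
    p +ₙ (n ∸ o)             ∎

  +ₙ-transpose⁻¹ : ∀ {o} (ℓ p : Fin n) → o ≤ n → ℓ ≡ p +ₙ (n ∸ o) → ℓ +ₙ o ≡ p
  +ₙ-transpose⁻¹ {o} ℓ p o≤n ℓ≡p-o = begin
    ℓ +ₙ o                   ≡⟨ cong (_+ₙ o) ℓ≡p-o ⟩
    (p +ₙ (n ∸ o)) +ₙ o      ≡⟨ +ₙ-assoc p (n ∸ o) o ⟩
    p +ₙ ((n ∸ o) + o)       ≡⟨ cong (p +ₙ_) (m∸n+n≡m o≤n) ⟩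
    p +ₙ n                   ≡⟨ +ₙ-period p ⟩
    p                        ∎

  δ-transpose : ∀ {o} (ℓ p : Fin n) → o ≤ n → δ p (ℓ +ₙ o) ≡ δ ℓ (p +ₙ (n ∸ o))
  δ-transpose ℓ p o≤n = ind-cong (p FP.≟ _) (ℓ FP.≟ _)
    (mk⇔ (λ p≡ℓ+o → +ₙ-transpose ℓ p o≤n (sym p≡ℓ+o))
         (λ ℓ≡p-o → sym (+ₙ-transpose⁻¹ ℓ p o≤n ℓ≡p-o)))

  -- translation by o is a bijection: every p has exactly one preimage
  δ-translate-sum : ∀ {o} (p : Fin n) → o ≤ n → sumFin (λ ℓ → δ p (ℓ +ₙ o)) ≡ 1
  δ-translate-sum {o} p o≤n = trans (sum-cong (λ ℓ → δ-transpose ℓ p o≤n)) (δ-sum (p +ₙ (n ∸ o)))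

  dist : Fin n → Fin n → ℕ
  dist ℓ p = toℕ (p +ₙ (n ∸ toℕ ℓ))

  dist<n : (ℓ p : Fin n) → dist ℓ p < n
  dist<n ℓ p = toℕ<n (p +ₙ (n ∸ toℕ ℓ))

  dist-spec : (ℓ p : Fin n) → ℓ +ₙ dist ℓ p ≡ p
  dist-spec ℓ p = toℕ-injective (begin
    toℕ (ℓ +ₙ dist ℓ p)                                ≡⟨ toℕ-+ₙ ℓ (dist ℓ p) ⟩
    (toℕ ℓ + toℕ (p +ₙ (n ∸ toℕ ℓ))) % n               ≡⟨ cong (λ r → (toℕ ℓ + r) % n) (toℕ-+ₙ p (n ∸ toℕ ℓ)) ⟩
    (toℕ ℓ + (toℕ p + (n ∸ toℕ ℓ)) % n) % n            ≡⟨ cong (_% n) (+-comm (toℕ ℓ) _) ⟩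
    ((toℕ p + (n ∸ toℕ ℓ)) % n + toℕ ℓ) % n            ≡⟨ %-absorbˡ (toℕ p + (n ∸ toℕ ℓ)) (toℕ ℓ) ⟩
    (toℕ p + (n ∸ toℕ ℓ) + toℕ ℓ) % n                  ≡⟨ cong (_% n) (trans (+-assoc (toℕ p) _ _)
                                                             (cong (toℕ p +_) (m∸n+n≡m (<⇒≤ (toℕ<n ℓ))))) ⟩
    (toℕ p + n) % n                                    ≡⟨ [m+n]%n≡m%n (toℕ p) n ⟩
    toℕ p % n                                          ≡⟨ toℕ%n p ⟩
    toℕ p                                              ∎)

  dist-unique : ∀ {c} (ℓ p : Fin n) → c < n → ℓ +ₙ c ≡ p → dist ℓ p ≡ c
  dist-unique {c} ℓ p c<n refl = begin
    toℕ ((ℓ +ₙ c) +ₙ (n ∸ toℕ ℓ))        ≡⟨ cong toℕ (+ₙ-assoc ℓ c (n ∸ toℕ ℓ)) ⟩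
    toℕ (ℓ +ₙ (c + (n ∸ toℕ ℓ)))          ≡⟨ toℕ-+ₙ ℓ (c + (n ∸ toℕ ℓ)) ⟩
    (toℕ ℓ + (c + (n ∸ toℕ ℓ))) % n       ≡⟨ cong (_% n) (rearrange (toℕ ℓ) c (n ∸ toℕ ℓ)) ⟩
    (c + (n ∸ toℕ ℓ + toℕ ℓ)) % n         ≡⟨ cong (λ r → (c + r) % n) (m∸n+n≡m (<⇒≤ (toℕ<n ℓ))) ⟩
    (c + n) % n                           ≡⟨ [m+n]%n≡m%n c n ⟩
    c % n                                 ≡⟨ m<n⇒m%n≡m c<n ⟩
    c                                     ∎
    where
    rearrange : ∀ a c d → a + (c + d) ≡ c + (d + a)
    rearrange = solve-∀

  dist-self : (p : Fin n) → dist p p ≡ 0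
  dist-self p = dist-unique p p (s≤s z≤n) (+ₙ-zero p)

  dist≡0⇒≡ : (p q : Fin n) → dist p q ≡ 0 → p ≡ q
  dist≡0⇒≡ p q d≡0 = trans (sym (+ₙ-zero p)) (trans (cong (p +ₙ_) (sym d≡0)) (dist-spec p q))

  +ₙ-no-fixpoint : ∀ {c} (ℓ : Fin n) → 1 ≤ c → c < n → ℓ +ₙ c ≢ ℓ
  +ₙ-no-fixpoint {suc c} ℓ _ c<n ℓ+c≡ℓ with trans (sym (dist-unique ℓ ℓ c<n ℓ+c≡ℓ)) (dist-self ℓ)
  ... | ()

  dist-sum : (p q : Fin n) → p ≢ q → dist p q + dist q p ≡ n
  dist-sum p q p≢q = begin
    d + dist q p        ≡⟨ cong (d +_) (dist-unique q p back<n (sym (+ₙ-transpose p q d≤n (dist-spec p q)))) ⟩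
    d + (n ∸ d)         ≡⟨ m+[n∸m]≡n d≤n ⟩
    n                   ∎
    where
    d : ℕ
    d = dist p q
    d≤n : d ≤ n
    d≤n = <⇒≤ (dist<n p q)
    back<n : n ∸ d < n
    back<n = ∸-monoʳ-< (n≢0⇒n>0 (λ d≡0 → p≢q (dist≡0⇒≡ p q d≡0))) d≤n

adjacency-as-sharing : ∀ {n} {a b c d : Fin n} → a ≢ b → c ≢ d → ¬ SameSet a b c d →
  ind (adjT? a b c d) ≡ (δ a c + δ a d) + (δ b c + δ b d)
adjacency-as-sharing {a = a} {b} {c} {d} a≢b c≢d different = begin
  ind (adjT? a b c d)
    ≡⟨ ind-× (¬? (sameSet? a b c d)) (shareA ⊎-dec shareB) ⟩
  ind (¬? (sameSet? a b c d)) * ind (shareA ⊎-dec shareB)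
    ≡⟨ cong (_* ind (shareA ⊎-dec shareB)) (notSame (sameSet? a b c d)) ⟩
  1 * ind (shareA ⊎-dec shareB)
    ≡⟨ *-identityˡ _ ⟩
  ind (shareA ⊎-dec shareB)
    ≡⟨ ind-⊎ shareA shareB ab-exclusive ⟩
  ind shareA + ind shareB
    ≡⟨ cong₂ _+_ (ind-⊎ (a FP.≟ c) (a FP.≟ d) (λ { (refl , refl) → c≢d refl }))
                 (ind-⊎ (b FP.≟ c) (b FP.≟ d) (λ { (refl , refl) → c≢d refl })) ⟩
  (δ a c + δ a d) + (δ b c + δ b d) ∎
  where
  shareA : Dec (a ≡ c ⊎ a ≡ d)
  shareA = (a FP.≟ c) ⊎-dec (a FP.≟ d)
  shareB : Dec (b ≡ c ⊎ b ≡ d)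
  shareB = (b FP.≟ c) ⊎-dec (b FP.≟ d)
  notSame : (p : Dec (SameSet a b c d)) → ind (¬? p) ≡ 1
  notSame (yes same) = ⊥-elim (different same)
  notSame (no _)     = refl
  ab-exclusive : ¬ ((a ≡ c ⊎ a ≡ d) × (b ≡ c ⊎ b ≡ d))
  ab-exclusive (inj₁ refl , inj₁ refl) = a≢b refl
  ab-exclusive (inj₁ refl , inj₂ refl) = different (inj₁ (refl , refl))
  ab-exclusive (inj₂ refl , inj₁ refl) = different (inj₂ (refl , refl))
  ab-exclusive (inj₂ refl , inj₂ refl) = a≢b refl

adjacency-irreflexive : ∀ {n} (a b : Fin n) → ind (adjT? a b a b) ≡ 0
adjacency-irreflexive a b with adjT? a b a b
... | yes (different , _) = ⊥-elim (different (inj₁ (refl , refl)))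
... | no _                = refl

adjacency-swapˡ : ∀ {n} (a b c d : Fin n) → ind (adjT? a b c d) ≡ ind (adjT? b a c d)
adjacency-swapˡ a b c d = ind-cong (adjT? a b c d) (adjT? b a c d) (mk⇔ swap swap)
  where
  swapSet : ∀ {x y u v : Fin _} → SameSet x y u v → SameSet y x u v
  swapSet (inj₁ (e₁ , e₂)) = inj₂ (e₂ , e₁)
  swapSet (inj₂ (e₁ , e₂)) = inj₁ (e₂ , e₁)
  swap : ∀ {x y u v : Fin _} → AdjT x y u v → AdjT y x u v
  swap (different , inj₁ share) = (different ∘ swapSet) , inj₂ share
  swap (different , inj₂ share) = (different ∘ swapSet) , inj₁ share

adjacency-swapʳ : ∀ {n} (a b c d : Fin n) → ind (adjT? a b c d) ≡ ind (adjT? a b d c)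
adjacency-swapʳ a b c d = ind-cong (adjT? a b c d) (adjT? a b d c) (mk⇔ swap swap)
  where
  swapSet : ∀ {x y u v : Fin _} → SameSet x y u v → SameSet x y v u
  swapSet (inj₁ e) = inj₂ e
  swapSet (inj₂ e) = inj₁ e
  swap : ∀ {x y u v : Fin _} → AdjT x y u v → AdjT x y v u
  swap (different , inj₁ share) = (different ∘ swapSet) , inj₁ (⊎-swap share)
  swap (different , inj₂ share) = (different ∘ swapSet) , inj₂ (⊎-swap share)

-- The triangular graph T(n), n = 2m + 1.  Its vertices are the edges of the
-- complete graph on the points Fin n; the edge {ℓ, ℓ + g} with 1 ≤ g ≤ m is
-- named (g − 1 , ℓ) : Fin m × Fin n, the first coordinate being its cell C_g.
-- T(n) is studied through the point–edge incidence matrix N: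
-- N Nᵀ = A + 2I  and  Nᵀ N = (n − 2) I + J.
module Triangular (m : ℕ) where

  open Cyclic {2 * m}

  n : ℕ
  n = suc (2 * m)

  Edge : Set
  Edge = Fin m × Fin n

  gap : Fin m → ℕ
  gap c = suc (toℕ c)

  gap≤m : ∀ c → gap c ≤ m
  gap≤m c = toℕ<n c

  ≤m⇒<n : ∀ {g} → g ≤ m → g < n
  ≤m⇒<n g≤m = s≤s (≤-trans g≤m (m≤m+n m (m + 0)))

  ≤m+≤m<n : ∀ {g h} → g ≤ m → h ≤ m → g + h < n
  ≤m+≤m<n {g} {h} g≤m h≤m = s≤s (subst (g + h ≤_) (cong (m +_) (sym (+-identityʳ m))) (+-mono-≤ g≤m h≤m))

  end₁ end₂ : Edge → Fin n
  end₁ (c , ℓ) = ℓ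
  end₂ (c , ℓ) = ℓ +ₙ gap c

  ends-distinct : ∀ e → end₁ e ≢ end₂ e
  ends-distinct (c , ℓ) ℓ≡ℓ+g = +ₙ-no-fixpoint ℓ (s≤s z≤n) (≤m⇒<n (gap≤m c)) (sym ℓ≡ℓ+g)

  sameSet⇒≡ : ∀ e f → SameSet (end₁ e) (end₂ e) (end₁ f) (end₂ f) → e ≡ f
  sameSet⇒≡ (c , ℓ) (c′ , .ℓ) (inj₁ (refl , ℓ+g≡ℓ+g′)) =
    cong (_, ℓ) (toℕ-injective (suc-injective (begin
      gap c          ≡⟨ sym (dist-unique ℓ _ (≤m⇒<n (gap≤m c)) refl) ⟩
      dist ℓ (ℓ +ₙ gap c)  ≡⟨ dist-unique ℓ _ (≤m⇒<n (gap≤m c′)) (sym ℓ+g≡ℓ+g′) ⟩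
      gap c′         ∎)))
  sameSet⇒≡ (c , ℓ) (c′ , ℓ′) (inj₂ (ℓ≡ℓ′+g′ , refl)) = ⊥-elim
    (+ₙ-no-fixpoint ℓ′ (s≤s z≤n) (≤m+≤m<n (gap≤m c′) (gap≤m c))
      (trans (sym (+ₙ-assoc ℓ′ (gap c′) (gap c))) (cong (_+ₙ gap c) (sym ℓ≡ℓ′+g′))))

  adj : Edge → Edge → ℕ
  adj e f = ind (adjT? (end₁ e) (end₂ e) (end₁ f) (end₂ f))

  incidence : Edge → Fin n → ℕ
  incidence e p = δ p (end₁ e) + δ p (end₂ e)

  shared : Edge → Edge → ℕ
  shared e f = sumFin (λ p → incidence e p * incidence f p)

  δE : Edge → Edge → ℕ
  δE (c , ℓ) (c′ , ℓ′) = δ c c′ * δ ℓ ℓ′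

  shared-ends : ∀ e f → shared e f ≡ (δ (end₁ e) (end₁ f) + δ (end₁ e) (end₂ f))
                                      + (δ (end₂ e) (end₁ f) + δ (end₂ e) (end₂ f))
  shared-ends e f = begin
    sumFin (λ p → (δ p (end₁ e) + δ p (end₂ e)) * incidence f p)
      ≡⟨ sum-cong (λ p → *-distribʳ-+ (incidence f p) (δ p (end₁ e)) (δ p (end₂ e))) ⟩
    sumFin (λ p → δ p (end₁ e) * incidence f p + δ p (end₂ e) * incidence f p)
      ≡⟨ sum-+ (λ p → δ p (end₁ e) * incidence f p) (λ p → δ p (end₂ e) * incidence f p) ⟩
    sumFin (λ p → δ p (end₁ e) * incidence f p) + sumFin (λ p → δ p (end₂ e) * incidence f p)
      ≡⟨ cong₂ _+_ (δ-sift (end₁ e) (incidence f)) (δ-sift (end₂ e) (incidence f)) ⟩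
    incidence f (end₁ e) + incidence f (end₂ e) ∎

  δE-refl : ∀ e → δE e e ≡ 1
  δE-refl (c , ℓ) = cong₂ _*_ (δ-refl c) (δ-refl ℓ)

  δE-≢ : ∀ {e f} → e ≢ f → δE e f ≡ 0
  δE-≢ {c , ℓ} {c′ , ℓ′} e≢f with c FP.≟ c′ | ℓ FP.≟ ℓ′
  ... | yes refl | yes refl = ⊥-elim (e≢f refl)
  ... | yes _    | no _     = *-zeroʳ 1
  ... | no _     | _        = refl

  _≟E_ : (e f : Edge) → Dec (e ≡ f)
  _≟E_ = ≡-dec FP._≟_ FP._≟_

  adj+2I≡shared : ∀ e f → adj e f + 2 * δE e f ≡ shared e f
  adj+2I≡shared e f = byEquality (e ≟E f)
    where
    byEquality : Dec (e ≡ f) → adj e f + 2 * δE e f ≡ shared e f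
    byEquality (yes refl) = begin
      adj e e + 2 * δE e e          ≡⟨ cong₂ (λ x y → x + 2 * y) (adjacency-irreflexive (end₁ e) (end₂ e)) (δE-refl e) ⟩
      2                             ≡⟨ cong₂ (λ x y → (1 + x) + (y + 1))
                                             (sym (δ-≢ (ends-distinct e)))
                                             (sym (δ-≢ (ends-distinct e ∘ sym))) ⟩
      (1 + δ (end₁ e) (end₂ e)) + (δ (end₂ e) (end₁ e) + 1)
                                    ≡⟨ sym (cong₂ (λ x y → (x + δ (end₁ e) (end₂ e)) + (δ (end₂ e) (end₁ e) + y))
                                                  (δ-refl (end₁ e)) (δ-refl (end₂ e))) ⟩
      (δ (end₁ e) (end₁ e) + δ (end₁ e) (end₂ e)) + (δ (end₂ e) (end₁ e) + δ (end₂ e) (end₂ e))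
                                    ≡⟨ sym (shared-ends e e) ⟩
      shared e e                    ∎
    byEquality (no e≢f) = begin
      adj e f + 2 * δE e f          ≡⟨ cong (λ x → adj e f + 2 * x) (δE-≢ e≢f) ⟩
      adj e f + 0                   ≡⟨ +-identityʳ _ ⟩
      adj e f                       ≡⟨ adjacency-as-sharing (ends-distinct e) (ends-distinct f)
                                                           (e≢f ∘ sameSet⇒≡ e f) ⟩
      (δ (end₁ e) (end₁ f) + δ (end₁ e) (end₂ f)) + (δ (end₂ e) (end₁ f) + δ (end₂ e) (end₂ f))
                                    ≡⟨ sym (shared-ends e f) ⟩
      shared e f                    ∎

  -- A + 2I = N Nᵀ is symmetric, hence so is A
  δE-sym : ∀ e f → δE e f ≡ δE f e
  δE-sym (c , ℓ) (c′ , ℓ′) = cong₂ _*_ (δ-sym c c′) (δ-sym ℓ ℓ′)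

  shared-sym : ∀ e f → shared e f ≡ shared f e
  shared-sym e f = sum-cong (λ p → *-comm (incidence e p) (incidence f p))

  adj-sym : ∀ e f → adj e f ≡ adj f e
  adj-sym e f = +-cancelʳ-≡ (2 * δE e f) (adj e f) (adj f e) (begin
    adj e f + 2 * δE e f   ≡⟨ adj+2I≡shared e f ⟩
    shared e f             ≡⟨ shared-sym e f ⟩
    shared f e             ≡⟨ sym (adj+2I≡shared f e) ⟩
    adj f e + 2 * δE f e   ≡⟨ cong (λ x → adj f e + 2 * x) (δE-sym f e) ⟩
    adj f e + 2 * δE e f   ∎)

  sumE : (Edge → ℕ) → ℕ
  sumE g = sumFin (λ i → g (remQuot {m} n i))

  sumE-cells : ∀ (g : Edge → ℕ) → sumE g ≡ sumFin (λ c → sumFin (λ ℓ → g (c , ℓ)))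
  sumE-cells g = sum-remQuot g

  δE-sift : ∀ e (h : Edge → ℕ) → sumE (λ f → δE e f * h f) ≡ h e
  δE-sift (c , ℓ) h = begin
    sumE (λ f → δE (c , ℓ) f * h f)
      ≡⟨ sumE-cells (λ f → δE (c , ℓ) f * h f) ⟩
    sumFin (λ c′ → sumFin (λ ℓ′ → δ c c′ * δ ℓ ℓ′ * h (c′ , ℓ′)))
      ≡⟨ sum-cong (λ c′ → trans (sum-cong (λ ℓ′ → *-assoc (δ c c′) (δ ℓ ℓ′) (h (c′ , ℓ′))))
                               (sum-*ˡ (δ c c′) (λ ℓ′ → δ ℓ ℓ′ * h (c′ , ℓ′)))) ⟩
    sumFin (λ c′ → δ c c′ * sumFin (λ ℓ′ → δ ℓ ℓ′ * h (c′ , ℓ′)))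
      ≡⟨ sum-cong (λ c′ → cong (δ c c′ *_) (δ-sift′ ℓ (λ ℓ′ → h (c′ , ℓ′)))) ⟩
    sumFin (λ c′ → δ c c′ * h (c′ , ℓ))
      ≡⟨ δ-sift′ c (λ c′ → h (c′ , ℓ)) ⟩
    h (c , ℓ) ∎

  δE-siftʳ : ∀ g (h : Edge → ℕ) → sumE (λ f → h f * δE f g) ≡ h g
  δE-siftʳ g h = trans (sum-cong (λ i → trans (*-comm (h (remQuot {m} n i)) _)
                                              (cong (_* h (remQuot {m} n i)) (δE-sym (remQuot {m} n i) g))))
                       (δE-sift g h)

  edgeSize : ∀ e → sumFin (incidence e) ≡ 2
  edgeSize e = trans (sum-+ (λ p → δ p (end₁ e)) (λ p → δ p (end₂ e)))
                     (cong₂ _+_ (δ-sum (end₁ e)) (δ-sum (end₂ e)))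

  cellIncidence : ∀ c p → sumFin (λ ℓ → incidence (c , ℓ) p) ≡ 2
  cellIncidence c p = trans (sum-+ (λ ℓ → δ p ℓ) (λ ℓ → δ p (ℓ +ₙ gap c)))
    (cong₂ _+_ (δ-sum′ p) (δ-translate-sum p (<⇒≤ (≤m⇒<n (gap≤m c)))))

  cellShared : ∀ c f → sumFin (λ ℓ → shared (c , ℓ) f) ≡ 4
  cellShared c f = begin
    sumFin (λ ℓ → sumFin (λ p → incidence (c , ℓ) p * incidence f p))
      ≡⟨ sum-swap (λ ℓ p → incidence (c , ℓ) p * incidence f p) ⟩
    sumFin (λ p → sumFin (λ ℓ → incidence (c , ℓ) p * incidence f p))
      ≡⟨ sum-cong (λ p → trans (sum-*ʳ (incidence f p) (λ ℓ → incidence (c , ℓ) p))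
                               (cong (_* incidence f p) (cellIncidence c p))) ⟩
    sumFin (λ p → 2 * incidence f p)
      ≡⟨ trans (sum-*ˡ 2 (incidence f)) (cong (2 *_) (edgeSize f)) ⟩
    4 ∎

  cellAdjacency : ∀ c f → sumFin (λ ℓ → adj (c , ℓ) f) + 2 * δ c (proj₁ f) ≡ 4
  cellAdjacency c f = begin
    sumFin (λ ℓ → adj (c , ℓ) f) + 2 * δ c (proj₁ f)
      ≡⟨ cong (λ x → sumFin (λ ℓ → adj (c , ℓ) f) + 2 * x) (sym sameCell) ⟩
    sumFin (λ ℓ → adj (c , ℓ) f) + 2 * sumFin (λ ℓ → δE (c , ℓ) f)
      ≡⟨ cong (sumFin (λ ℓ → adj (c , ℓ) f) +_) (sym (sum-*ˡ 2 (λ ℓ → δE (c , ℓ) f))) ⟩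
    sumFin (λ ℓ → adj (c , ℓ) f) + sumFin (λ ℓ → 2 * δE (c , ℓ) f)
      ≡⟨ sym (sum-+ (λ ℓ → adj (c , ℓ) f) (λ ℓ → 2 * δE (c , ℓ) f)) ⟩
    sumFin (λ ℓ → adj (c , ℓ) f + 2 * δE (c , ℓ) f)
      ≡⟨ sum-cong (λ ℓ → adj+2I≡shared (c , ℓ) f) ⟩
    sumFin (λ ℓ → shared (c , ℓ) f)
      ≡⟨ cellShared c f ⟩
    4 ∎
    where
    sameCell : sumFin (λ ℓ → δE (c , ℓ) f) ≡ δ c (proj₁ f)
    sameCell = trans (sum-*ˡ (δ c (proj₁ f)) (λ ℓ → δ ℓ (proj₂ f)))
                     (trans (cong (δ c (proj₁ f) *_) (δ-sum (proj₂ f))) (*-identityʳ _))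

  inDegree+2 : ∀ f → sumE (λ e → adj e f) + 2 ≡ 4 * m
  inDegree+2 f = begin
    sumE (λ e → adj e f) + 2
      ≡⟨ cong₂ _+_ (sumE-cells (λ e → adj e f))
                   (sym (trans (sum-*ˡ 2 (λ c → δ c (proj₁ f))) (cong (2 *_) (δ-sum (proj₁ f))))) ⟩
    sumFin (λ c → sumFin (λ ℓ → adj (c , ℓ) f)) + sumFin (λ c → 2 * δ c (proj₁ f))
      ≡⟨ sym (sum-+ (λ c → sumFin (λ ℓ → adj (c , ℓ) f)) (λ c → 2 * δ c (proj₁ f))) ⟩
    sumFin (λ c → sumFin (λ ℓ → adj (c , ℓ) f) + 2 * δ c (proj₁ f))
      ≡⟨ sum-cong (λ c → cellAdjacency c f) ⟩
    sumFin {m} (λ _ → 4)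
      ≡⟨ trans (sum-const {m} 4) (*-comm m 4) ⟩
    4 * m ∎

  short : ℕ → ℕ
  short zero    = 0
  short (suc d) = ind (suc d ≤? m)

  gapCount : ∀ d → sumFin (λ c → ind (d ℕ.≟ gap c)) ≡ short d
  gapCount zero    = sum-zero (λ c → ind-no (0 ℕ.≟ gap c) (λ ()))
  gapCount (suc d) = byRange (suc d ≤? m)
    where
    byRange : (r : Dec (suc d ≤ m)) → sumFin (λ c → ind (suc d ℕ.≟ gap c)) ≡ ind r
    byRange (yes d<m) = trans (sum-cong (λ c → ind-cong (suc d ℕ.≟ gap c) (c FP.≟ c₀)
                                (mk⇔ (λ e → toℕ-injective (trans (sym (suc-injective e)) (sym (toℕ-fromℕ< d<m))))
                                     (λ { refl → cong suc (sym (toℕ-fromℕ< d<m)) }))))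
                              (δ-sum c₀)
      where
      c₀ : Fin m
      c₀ = fromℕ< d<m
    byRange (no d≰m)  = sum-zero (λ c → ind-no (suc d ℕ.≟ gap c) (λ { refl → d≰m (gap≤m c) }))

  gapHit : ∀ c p q → δ q (p +ₙ gap c) ≡ ind (dist p q ℕ.≟ gap c)
  gapHit c p q = ind-cong (q FP.≟ (p +ₙ gap c)) (dist p q ℕ.≟ gap c)
    (mk⇔ (λ q≡ → dist-unique p q (≤m⇒<n (gap≤m c)) (sym q≡))
         (λ d≡g → sym (trans (cong (p +ₙ_) (sym d≡g)) (dist-spec p q))))

  shortDistances : ∀ p q → short (dist p q) + short (dist q p) + δ q p ≡ 1
  shortDistances p q = byEquality (q FP.≟ p)
    where
    oneShort : ∀ d₁ d₂ → d₁ ≢ 0 → d₂ ≢ 0 → d₁ + d₂ ≡ n → short d₁ + short d₂ ≡ 1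
    oneShort zero     _        d₁≢0 _    _ = ⊥-elim (d₁≢0 refl)
    oneShort (suc _)  zero     _    d₂≢0 _ = ⊥-elim (d₂≢0 refl)
    oneShort (suc a) (suc b) _ _ sum≡n with suc a ≤? m | suc b ≤? m
    ... | yes a<m | yes b<m = ⊥-elim (<-irrefl sum≡n (≤m+≤m<n a<m b<m))
    ... | yes _   | no _    = refl
    ... | no _    | yes _   = refl
    ... | no a≥m  | no b≥m  = ⊥-elim (<-irrefl (sym sum≡n)
                                  (subst (_≤ suc a + suc b)
                                         (cong suc (trans (+-suc m m) (cong (λ x → suc (m + x)) (sym (+-identityʳ m)))))
                                         (+-mono-≤ (≰⇒> a≥m) (≰⇒> b≥m))))
    byEquality : Dec (q ≡ p) → short (dist p q) + short (dist q p) + δ q p ≡ 1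
    byEquality (yes refl) = cong₂ (λ d x → short d + short d + x) (dist-self p) (δ-refl p)
    byEquality (no q≢p)   = trans (cong (short (dist p q) + short (dist q p) +_) (δ-≢ q≢p))
      (trans (+-identityʳ _)
        (oneShort (dist p q) (dist q p) (q≢p ∘ sym ∘ dist≡0⇒≡ p q) (q≢p ∘ dist≡0⇒≡ q p)
                  (dist-sum p q (q≢p ∘ sym))))

  -- the edges of the cell c through both p and q: p is their first point
  -- and q = p + g or q = p, or p is their second point and p = q + g or q = p
  cellPairCount : ∀ c p q → sumFin (λ ℓ → incidence (c , ℓ) p * incidence (c , ℓ) q)
                            ≡ (δ q p + δ q (p +ₙ gap c)) + (δ p (q +ₙ gap c) + δ q p)
  cellPairCount c p q = begin
    sumFin (λ ℓ → (δ p ℓ + δ p (ℓ +ₙ g)) * Y ℓ)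
      ≡⟨ sum-cong (λ ℓ → *-distribʳ-+ (Y ℓ) (δ p ℓ) (δ p (ℓ +ₙ g))) ⟩
    sumFin (λ ℓ → δ p ℓ * Y ℓ + δ p (ℓ +ₙ g) * Y ℓ)
      ≡⟨ sum-+ (λ ℓ → δ p ℓ * Y ℓ) (λ ℓ → δ p (ℓ +ₙ g) * Y ℓ) ⟩
    sumFin (λ ℓ → δ p ℓ * Y ℓ) + sumFin (λ ℓ → δ p (ℓ +ₙ g) * Y ℓ)
      ≡⟨ cong₂ _+_ (δ-sift′ p Y)
                   (trans (sum-cong (λ ℓ → cong (_* Y ℓ) (δ-transpose ℓ p g≤n))) (δ-sift p′ Y)) ⟩
    Y p + Y p′
      ≡⟨ cong (Y p +_) (cong₂ _+_ (sym (δ-transpose q p g≤n))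
                                   (cong (δ q) (+ₙ-transpose⁻¹ p′ p g≤n refl))) ⟩
    (δ q p + δ q (p +ₙ g)) + (δ p (q +ₙ g) + δ q p) ∎
    where
    g : ℕ
    g = gap c
    g≤n : g ≤ n
    g≤n = <⇒≤ (≤m⇒<n (gap≤m c))
    p′ : Fin n
    p′ = p +ₙ (n ∸ g)
    Y : Fin n → ℕ
    Y ℓ = incidence (c , ℓ) q

  -- Nᵀ N = (n − 2) I + J: a point lies on 2m edges, two points on one edge
  pairCount : ∀ p q → sumE (λ e → incidence e p * incidence e q) + δ q p ≡ 2 * m * δ q p + 1
  pairCount p q = begin
    sumE (λ e → incidence e p * incidence e q) + δ q p
      ≡⟨ cong (_+ δ q p) (trans (sumE-cells (λ e → incidence e p * incidence e q))
                                (sum-cong (λ c → trans (cellPairCount c p q) (regroup (δ q p) (δ q (p +ₙ gap c)) (δ p (q +ₙ gap c)))))) ⟩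
    sumFin (λ c → 2 * δ q p + (δ q (p +ₙ gap c) + δ p (q +ₙ gap c))) + δ q p
      ≡⟨ cong (_+ δ q p) (trans (sum-+ (λ _ → 2 * δ q p) (λ c → δ q (p +ₙ gap c) + δ p (q +ₙ gap c)))
                                (cong₂ _+_ (sum-const {m} (2 * δ q p))
                                           (sum-+ (λ c → δ q (p +ₙ gap c)) (λ c → δ p (q +ₙ gap c))))) ⟩
    m * (2 * δ q p) + (sumFin (λ c → δ q (p +ₙ gap c)) + sumFin (λ c → δ p (q +ₙ gap c))) + δ q p
      ≡⟨ cong (λ x → m * (2 * δ q p) + x + δ q p)
              (cong₂ _+_ (trans (sum-cong (λ c → gapHit c p q)) (gapCount (dist p q)))
                         (trans (sum-cong (λ c → gapHit c q p)) (gapCount (dist q p)))) ⟩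
    m * (2 * δ q p) + (short (dist p q) + short (dist q p)) + δ q p
      ≡⟨ regroup′ m (δ q p) (short (dist p q) + short (dist q p)) ⟩
    2 * m * δ q p + (short (dist p q) + short (dist q p) + δ q p)
      ≡⟨ cong (2 * m * δ q p +_) (shortDistances p q) ⟩
    2 * m * δ q p + 1 ∎
    where
    regroup : ∀ a b c → (a + b) + (c + a) ≡ 2 * a + (b + c)
    regroup = solve-∀
    regroup′ : ∀ m d s → m * (2 * d) + s + d ≡ 2 * m * d + (s + d)
    regroup′ = solve-∀

  ΣΣ : (Fin n → Fin n → ℕ) → ℕ
  ΣΣ H = sumFin (λ p → sumFin (λ q → H p q))

  ΣΣ-cong : ∀ {H H′ : Fin n → Fin n → ℕ} → (∀ p q → H p q ≡ H′ p q) → ΣΣ H ≡ ΣΣ H′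
  ΣΣ-cong H≗H′ = sum-cong (λ p → sum-cong (H≗H′ p))

  ΣΣ-+ : ∀ H H′ → ΣΣ (λ p q → H p q + H′ p q) ≡ ΣΣ H + ΣΣ H′
  ΣΣ-+ H H′ = trans (sum-cong (λ p → sum-+ (H p) (H′ p)))
                    (sum-+ (λ p → sumFin (H p)) (λ p → sumFin (H′ p)))

  -- N Nᵀ N Nᵀ = N (Nᵀ N) Nᵀ: walks e – f – g through points p ∈ e ∩ f, q ∈ f ∩ g
  throughPoints : ∀ e g → sumE (λ f → shared e f * shared f g)
                          ≡ ΣΣ (λ p q → incidence e p * incidence g q * sumE (λ f → incidence f p * incidence f q))
  throughPoints e g = begin
    sumE (λ f → shared e f * shared f g)
      ≡⟨ sum-cong (λ i → let f = remQuot {m} n i in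
           trans (sum-product (λ p → incidence e p * incidence f p) (λ q → incidence f q * incidence g q))
                 (ΣΣ-cong (λ p q → regroup (incidence e p) (incidence f p) (incidence f q) (incidence g q)))) ⟩
    sumE (λ f → ΣΣ (λ p q → F p q * (incidence f p * incidence f q)))
      ≡⟨ sum-swap (λ i p → sumFin (λ q → F p q * pair i p q)) ⟩
    sumFin (λ p → sumE (λ f → sumFin (λ q → F p q * (incidence f p * incidence f q))))
      ≡⟨ sum-cong (λ p → sum-swap (λ i q → F p q * pair i p q)) ⟩
    ΣΣ (λ p q → sumE (λ f → F p q * (incidence f p * incidence f q)))
      ≡⟨ ΣΣ-cong (λ p q → sum-*ˡ (F p q) (λ i → pair i p q)) ⟩
    ΣΣ (λ p q → F p q * sumE (λ f → incidence f p * incidence f q)) ∎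
    where
    F : Fin n → Fin n → ℕ
    F p q = incidence e p * incidence g q
    pair : Fin (m * n) → Fin n → Fin n → ℕ
    pair i p q = incidence (remQuot {m} n i) p * incidence (remQuot {m} n i) q
    regroup : ∀ a b c d → (a * b) * (c * d) ≡ (a * d) * (b * c)
    regroup = solve-∀

  -- (N Nᵀ)² + N Nᵀ = 2m N Nᵀ + 4J, by Nᵀ N + I = 2m I + J
  sharedSquare : ∀ e g → sumE (λ f → shared e f * shared f g) + shared e g ≡ 2 * m * shared e g + 4
  sharedSquare e g = begin
    sumE (λ f → shared e f * shared f g) + shared e g
      ≡⟨ cong₂ _+_ (throughPoints e g) (sym diagonal) ⟩
    ΣΣ (λ p q → F p q * K p q) + ΣΣ (λ p q → F p q * δ q p)
      ≡⟨ sym (ΣΣ-+ (λ p q → F p q * K p q) (λ p q → F p q * δ q p)) ⟩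
    ΣΣ (λ p q → F p q * K p q + F p q * δ q p)
      ≡⟨ ΣΣ-cong (λ p q → trans (sym (*-distribˡ-+ (F p q) (K p q) (δ q p)))
                          (trans (cong (F p q *_) (pairCount p q)) (distribute (F p q) m (δ q p)))) ⟩
    ΣΣ (λ p q → 2 * m * (F p q * δ q p) + F p q)
      ≡⟨ ΣΣ-+ (λ p q → 2 * m * (F p q * δ q p)) F ⟩
    ΣΣ (λ p q → 2 * m * (F p q * δ q p)) + ΣΣ F
      ≡⟨ cong₂ _+_ (trans (sum-cong (λ p → sum-*ˡ (2 * m) (λ q → F p q * δ q p)))
                          (sum-*ˡ (2 * m) (λ p → sumFin (λ q → F p q * δ q p))))
                   (sym (sum-product (incidence e) (incidence g))) ⟩
    2 * m * ΣΣ (λ p q → F p q * δ q p) + sumFin (incidence e) * sumFin (incidence g)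
      ≡⟨ cong₂ _+_ (cong (2 * m *_) diagonal) (cong₂ _*_ (edgeSize e) (edgeSize g)) ⟩
    2 * m * shared e g + 4 ∎
    where
    F K : Fin n → Fin n → ℕ
    F p q = incidence e p * incidence g q
    K p q = sumE (λ f → incidence f p * incidence f q)
    distribute : ∀ x m d → x * (2 * m * d + 1) ≡ 2 * m * (x * d) + x
    distribute = solve-∀
    diagonal : ΣΣ (λ p q → F p q * δ q p) ≡ shared e g
    diagonal = sum-cong (λ p → trans (sum-cong (λ q → *-comm (F p q) (δ q p)))
                                     (δ-sift p (λ q → F p q)))

  sharedSquare-adj : ∀ e g → sumE (λ f → shared e f * shared f g)
                             ≡ sumE (λ f → adj e f * adj f g) + 2 * adj e g + 2 * adj e g + 4 * δE e g
  sharedSquare-adj e g = begin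
    sumE (λ f → shared e f * shared f g)
      ≡⟨ sum-cong (λ i → sym (cong₂ _*_ (adj+2I≡shared e (vertex i)) (adj+2I≡shared (vertex i) g))) ⟩
    sumE (λ f → (adj e f + 2 * δE e f) * (adj f g + 2 * δE f g))
      ≡⟨ sum-expand (λ i → adj e (vertex i)) (λ i → 2 * δE e (vertex i))
                    (λ i → adj (vertex i) g) (λ i → 2 * δE (vertex i) g) ⟩
    AA + sumE (λ f → adj e f * (2 * δE f g)) + sumE (λ f → (2 * δE e f) * adj f g)
       + sumE (λ f → (2 * δE e f) * (2 * δE f g))
      ≡⟨ cong₂ _+_ (cong₂ (λ x y → AA + x + y)
           (trans (sum-cong (λ i → swap₁ (adj e (vertex i)) (δE (vertex i) g)))
                  (δE-siftʳ g (λ f → 2 * adj e f)))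
           (trans (sum-cong (λ i → swap₂ (δE e (vertex i)) (adj (vertex i) g)))
                  (δE-sift e (λ f → 2 * adj f g))))
           (trans (sum-cong (λ i → swap₂ (δE e (vertex i)) (2 * δE (vertex i) g)))
                  (trans (δE-sift e (λ f → 2 * (2 * δE f g))) (sym (*-assoc 2 2 (δE e g))))) ⟩
    AA + 2 * adj e g + 2 * adj e g + 4 * δE e g ∎
    where
    AA : ℕ
    AA = sumE (λ f → adj e f * adj f g)
    vertex : Fin (m * n) → Edge
    vertex = remQuot {m} n
    swap₁ : ∀ a b → a * (2 * b) ≡ (2 * a) * b
    swap₁ = solve-∀
    swap₂ : ∀ a b → (2 * a) * b ≡ a * (2 * b)
    swap₂ = solve-∀

  srgRelation : ∀ e g → sumE (λ f → adj e f * adj f g) + 5 * adj e g + 6 * δE e g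
                        ≡ 2 * m * adj e g + 4 * m * δE e g + 4
  srgRelation e g = begin
    AA + 5 * A + 6 * I
      ≡⟨ regroup AA A I ⟩
    (AA + 2 * A + 2 * A + 4 * I) + (A + 2 * I)
      ≡⟨ cong₂ _+_ (sym (sharedSquare-adj e g)) (adj+2I≡shared e g) ⟩
    sumE (λ f → shared e f * shared f g) + shared e g
      ≡⟨ sharedSquare e g ⟩
    2 * m * shared e g + 4
      ≡⟨ cong (λ x → 2 * m * x + 4) (sym (adj+2I≡shared e g)) ⟩
    2 * m * (A + 2 * I) + 4
      ≡⟨ regroup′ m A I ⟩
    2 * m * A + 4 * m * I + 4 ∎
    where
    AA A I : ℕ
    AA = sumE (λ f → adj e f * adj f g)
    A = adj e g
    I = δE e g
    regroup : ∀ x a i → x + 5 * a + 6 * i ≡ (x + 2 * a + 2 * a + 4 * i) + (a + 2 * i)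
    regroup = solve-∀
    regroup′ : ∀ m a i → 2 * m * (a + 2 * i) + 4 ≡ 2 * m * a + 4 * m * i + 4
    regroup′ = solve-∀

  classify : ∀ e g → (δE e g ≡ 1 × adj e g ≡ 0) ⊎ (δE e g ≡ 0 × adj e g ≡ 1) ⊎ (δE e g ≡ 0 × adj e g ≡ 0)
  classify e g = byEquality (e ≟E g)
    where
    byEquality : Dec (e ≡ g) → (δE e g ≡ 1 × adj e g ≡ 0) ⊎ (δE e g ≡ 0 × adj e g ≡ 1) ⊎ (δE e g ≡ 0 × adj e g ≡ 0)
    byEquality (yes refl) = inj₁ (δE-refl e , adjacency-irreflexive (end₁ e) (end₂ e))
    byEquality (no e≢g) with ind-zeroOne (adjT? (end₁ e) (end₂ e) (end₁ g) (end₂ g))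
    ... | inj₁ A≡0 = inj₂ (inj₂ (δE-≢ e≢g , A≡0))
    ... | inj₂ A≡1 = inj₂ (inj₁ (δE-≢ e≢g , A≡1))

  srgParameters : ∀ AA {I A} → (I ≡ 1 × A ≡ 0) ⊎ (I ≡ 0 × A ≡ 1) ⊎ (I ≡ 0 × A ≡ 0) →
                  AA + 5 * A + 6 * I ≡ 2 * m * A + 4 * m * I + 4 →
                  AA ≡ dsrgRHS (4 * m ∸ 2) (2 * m ∸ 1) 4 I A
  srgParameters AA (inj₁ (refl , refl)) relation = begin
    AA                    ≡⟨ solveFor (trans (identity AA) (trans relation (identity′ m))) ⟩
    (4 * m + 4) ∸ (4 + 2) ≡⟨ sym (∸-+-assoc (4 * m + 4) 4 2) ⟩
    (4 * m + 4) ∸ 4 ∸ 2   ≡⟨ cong (_∸ 2) (m+n∸n≡m (4 * m) 4) ⟩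
    4 * m ∸ 2             ≡⟨ sym (rhs-identity (4 * m ∸ 2) (2 * m ∸ 1) 4) ⟩
    dsrgRHS (4 * m ∸ 2) (2 * m ∸ 1) 4 1 0 ∎
    where
    identity : ∀ x → x + (4 + 2) ≡ x + 5 * 0 + 6 * 1
    identity = solve-∀
    identity′ : ∀ m → 2 * m * 0 + 4 * m * 1 + 4 ≡ 4 * m + 4
    identity′ = solve-∀
  srgParameters AA (inj₂ (inj₁ (refl , refl))) relation = begin
    AA                    ≡⟨ solveFor (trans (arc AA) (trans relation (arc′ m))) ⟩
    (2 * m + 4) ∸ (4 + 1) ≡⟨ sym (∸-+-assoc (2 * m + 4) 4 1) ⟩
    (2 * m + 4) ∸ 4 ∸ 1   ≡⟨ cong (_∸ 1) (m+n∸n≡m (2 * m) 4) ⟩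
    2 * m ∸ 1             ≡⟨ sym (rhs-arc (4 * m ∸ 2) (2 * m ∸ 1) 4) ⟩
    dsrgRHS (4 * m ∸ 2) (2 * m ∸ 1) 4 0 1 ∎
    where
    arc : ∀ x → x + (4 + 1) ≡ x + 5 * 1 + 6 * 0
    arc = solve-∀
    arc′ : ∀ m → 2 * m * 1 + 4 * m * 0 + 4 ≡ 2 * m + 4
    arc′ = solve-∀
  srgParameters AA (inj₂ (inj₂ (refl , refl))) relation = begin
    AA                    ≡⟨ trans (nonArc AA) (trans relation (nonArc′ m)) ⟩
    4                     ≡⟨ sym (rhs-nonArc (4 * m ∸ 2) (2 * m ∸ 1) 4) ⟩
    dsrgRHS (4 * m ∸ 2) (2 * m ∸ 1) 4 0 0 ∎
    where
    nonArc : ∀ x → x ≡ x + 5 * 0 + 6 * 0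
    nonArc = solve-∀
    nonArc′ : ∀ m → 2 * m * 0 + 4 * m * 0 + 4 ≡ 4
    nonArc′ = solve-∀

  adjacencySquare : ∀ e g → sumE (λ f → adj e f * adj f g)
                            ≡ dsrgRHS (4 * m ∸ 2) (2 * m ∸ 1) 4 (δE e g) (adj e g)
  adjacencySquare e g = srgParameters (sumE (λ f → adj e f * adj f g)) (classify e g) (srgRelation e g)

  inDegree : ∀ f → sumE (λ e → adj e f) ≡ 4 * m ∸ 2
  inDegree f = solveFor (inDegree+2 f)

  outDegree : ∀ e → sumE (λ f → adj e f) ≡ 4 * m ∸ 2
  outDegree e = trans (sum-cong (λ i → adj-sym e (remQuot {m} n i))) (inDegree e)

  adjMat : Mat (m * n)
  adjMat i k = adj (remQuot n i) (remQuot n k)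

  cellOf : Fin (m * n) → Fin m
  cellOf i = proj₁ (remQuot n i)

  isSRG : IsDSRG adjMat (4 * m ∸ 2) (4 * m ∸ 2) (2 * m ∸ 1) 4
  isSRG = record
    { zeroOne  = λ i k → ind-zeroOne (adjT? _ _ _ _)
    ; loopless = λ i → adjacency-irreflexive _ _
    ; AJ≡kJ    = λ i k → trans (sum-cong (λ i′ → *-identityʳ (adjMat i i′)))
                               (trans (outDegree (remQuot n i)) (sym (*-identityʳ _)))
    ; JA≡kJ    = λ i k → trans (sum-cong (λ i′ → *-identityˡ (adjMat i′ k)))
                               (trans (inDegree (remQuot n k)) (sym (*-identityʳ _)))
    ; A²-eq    = λ i k → trans (adjacencySquare (remQuot n i) (remQuot n k))
                               (cong (λ I → dsrgRHS (4 * m ∸ 2) (2 * m ∸ 1) 4 I (adjMat i k))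
                                     (sym (trans (Im≡δ i k) (δ-remQuot {m} {n} i k))))
    }

  inFromCell : ∀ c k → inFrom adjMat cellOf c k ≡ sumFin (λ ℓ → adj (c , ℓ) (remQuot n k))
  inFromCell c k = begin
    inFrom adjMat cellOf c k
      ≡⟨ sumE-cells (λ e → δ (proj₁ e) c * adj e f) ⟩
    sumFin (λ c′ → sumFin (λ ℓ → δ c′ c * adj (c′ , ℓ) f))
      ≡⟨ sum-cong (λ c′ → sum-*ˡ (δ c′ c) (λ ℓ → adj (c′ , ℓ) f)) ⟩
    sumFin (λ c′ → δ c′ c * sumFin (λ ℓ → adj (c′ , ℓ) f))
      ≡⟨ δ-sift c (λ c′ → sumFin (λ ℓ → adj (c′ , ℓ) f)) ⟩
    sumFin (λ ℓ → adj (c , ℓ) f) ∎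
    where
    f : Edge
    f = remQuot n k

  cellsEquitable : InEquitable adjMat cellOf n 2 4
  cellsEquitable = record
    { cellSize    = λ c → begin
        sumFin (λ i → δ (cellOf i) c)
          ≡⟨ sumE-cells (λ e → δ (proj₁ e) c) ⟩
        sumFin (λ c′ → sumFin {n} (λ _ → δ c′ c))
          ≡⟨ sum-cong (λ c′ → trans (sum-const {n} (δ c′ c)) (*-comm n (δ c′ c))) ⟩
        sumFin (λ c′ → δ c′ c * n)
          ≡⟨ δ-sift c (λ _ → n) ⟩
        n ∎
    ; inOwnCell   = λ k → +-cancelʳ-≡ 2 _ 2 (begin
        inFrom adjMat cellOf (cellOf k) k + 2
          ≡⟨ cong₂ _+_ (inFromCell (cellOf k) k) (cong (2 *_) (sym (δ-refl (cellOf k)))) ⟩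
        sumFin (λ ℓ → adj (cellOf k , ℓ) (remQuot n k)) + 2 * δ (cellOf k) (cellOf k)
          ≡⟨ cellAdjacency (cellOf k) (remQuot n k) ⟩
        4 ∎)
    ; inOtherCell = λ c k c≢cell → begin
        inFrom adjMat cellOf c k
          ≡⟨ inFromCell c k ⟩
        sumFin (λ ℓ → adj (c , ℓ) (remQuot n k))
          ≡⟨ sym (trans (cong (λ x → sumFin (λ ℓ → adj (c , ℓ) (remQuot n k)) + 2 * x) (δ-≢ c≢cell)) (+-identityʳ _)) ⟩
        sumFin (λ ℓ → adj (c , ℓ) (remQuot n k)) + 2 * δ c (cellOf k)
          ≡⟨ cellAdjacency c (remQuot n k) ⟩
        4 ∎
    }

-- The partition π = {C_1, …, C_m} of T(n) in the formulation of Defs: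
-- C_g consists of the 2-subsets at cyclic distance g.
module Partition (m : ℕ) where

  open Cyclic {2 * m}
  open Triangular m

  inC⇒dist : ∀ {g} {a b : Fin n} → g ≤ m → InC g a b → g ≡ dist a b ⊎ g ≡ dist b a
  inC⇒dist g≤m (ℓ , inj₁ (refl , refl)) = inj₁ (sym (dist-unique ℓ _ (≤m⇒<n g≤m) refl))
  inC⇒dist g≤m (ℓ , inj₂ (refl , refl)) = inj₂ (sym (dist-unique ℓ _ (≤m⇒<n g≤m) refl))

  ≢-of-< : ∀ {a b : Fin n} → IsVert {n} a b → a ≢ b
  ≢-of-< a<b refl = <-irrefl refl a<b

  nonempty : ∀ g → 1 ≤ g → g ≤ m → ∃[ a ] ∃[ b ] (IsVert {n} a b × InC g a b)
  nonempty g 1≤g g≤m = F.zero , (F.zero +ₙ g) , zero<g , (F.zero , inj₁ (refl , refl))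
    where
    zero<g : F._<_ {n} F.zero (F.zero +ₙ g)
    zero<g = subst (1 ≤_) (sym (trans (toℕ-+ₙ F.zero g) (m<n⇒m%n≡m (≤m⇒<n g≤m)))) 1≤g

  -- {a , b} lies in the cell of the shorter of its two distances
  cover : ∀ (a b : Fin n) → IsVert a b → ∃[ g ] (1 ≤ g × g ≤ m × InC g a b)
  cover a b a<b with dist a b ≤? m
  ... | yes d≤m = dist a b , positive a b (≢-of-< a<b) , d≤m , (a , inj₁ (refl , sym (dist-spec a b)))
    where
    positive : ∀ p q → p ≢ q → 1 ≤ dist p q
    positive p q p≢q = n≢0⇒n>0 (p≢q ∘ dist≡0⇒≡ p q)
  ... | no d≰m = dist b a , n≢0⇒n>0 (≢-of-< a<b ∘ sym ∘ dist≡0⇒≡ b a) , back≤m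
                         , (b , inj₂ (sym (dist-spec b a) , refl))
    where
    back≤m : dist b a ≤ m
    back≤m = +-cancelˡ-≤ (suc m) (dist b a) m
               (subst (suc m + dist b a ≤_) aroundTheCycle (+-monoˡ-≤ (dist b a) (≰⇒> d≰m)))
      where
      aroundTheCycle : dist a b + dist b a ≡ suc m + m
      aroundTheCycle = trans (dist-sum a b (≢-of-< a<b)) (cong suc (cong (m +_) (+-identityʳ m)))

  -- and in no other cell, since the two distances add up to 2m + 1
  disjoint : ∀ (a b : Fin n) → IsVert a b → ∀ g g′ → 1 ≤ g → g ≤ m → 1 ≤ g′ → g′ ≤ m
             → InC g a b → InC g′ a b → g ≡ g′
  disjoint a b a<b g g′ _ g≤m _ g′≤m g∈ g′∈ with inC⇒dist g≤m g∈ | inC⇒dist g′≤m g′∈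
  ... | inj₁ e | inj₁ e′ = trans e (sym e′)
  ... | inj₂ e | inj₂ e′ = trans e (sym e′)
  ... | inj₁ e | inj₂ e′ = ⊥-elim (<-irrefl (trans (cong₂ _+_ e e′) (dist-sum a b (≢-of-< a<b))) (≤m+≤m<n g≤m g′≤m))
  ... | inj₂ e | inj₁ e′ = ⊥-elim (<-irrefl (trans (cong₂ _+_ e′ e) (dist-sum a b (≢-of-< a<b))) (≤m+≤m<n g′≤m g≤m))

  inC-indicator : ∀ l → 1 ≤ l → l ≤ m → (c d : Fin n) → ind (inC? l c d) ≡ δ d (c +ₙ l) + δ c (d +ₙ l)
  inC-indicator l 1≤l l≤m c d = begin
    ind (inC? l c d)
      ≡⟨ ind-cong (inC? l c d) ((d FP.≟ (c +ₙ l)) ⊎-dec (c FP.≟ (d +ₙ l))) (mk⇔ to from) ⟩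
    ind ((d FP.≟ (c +ₙ l)) ⊎-dec (c FP.≟ (d +ₙ l)))
      ≡⟨ ind-⊎ (d FP.≟ (c +ₙ l)) (c FP.≟ (d +ₙ l)) notBoth ⟩
    δ d (c +ₙ l) + δ c (d +ₙ l) ∎
    where
    to : InC l c d → d ≡ c +ₙ l ⊎ c ≡ d +ₙ l
    to (ℓ , inj₁ (refl , d≡)) = inj₁ d≡
    to (ℓ , inj₂ (c≡ , refl)) = inj₂ c≡
    from : d ≡ c +ₙ l ⊎ c ≡ d +ₙ l → InC l c d
    from (inj₁ d≡) = c , inj₁ (refl , d≡)
    from (inj₂ c≡) = d , inj₂ (c≡ , refl)
    notBoth : ¬ (d ≡ c +ₙ l × c ≡ d +ₙ l)
    notBoth (d≡ , c≡) = +ₙ-no-fixpoint c (≤-trans 1≤l (m≤m+n l l)) (≤m+≤m<n l≤m l≤m)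
      (trans (sym (+ₙ-assoc c l l)) (trans (cong (_+ₙ l) (sym d≡)) (sym c≡)))

  ordered : ∀ (c d : Fin n) → c ≢ d → ind (c FP.<? d) + ind (d FP.<? c) ≡ 1
  ordered c d c≢d with c FP.<? d | d FP.<? c
  ... | yes c<d | yes d<c = ⊥-elim (<-asym c<d d<c)
  ... | yes _   | no _    = refl
  ... | no _    | yes _   = refl
  ... | no c≮d  | no d≮c  = ⊥-elim (c≢d (toℕ-injective (≤-antisym (≮⇒≥ d≮c) (≮⇒≥ c≮d))))

  pairInCell? : ∀ l (a b c d : Fin n) → Dec (IsVert c d × (AdjT a b c d × InC l c d))
  pairInCell? l a b c d = (c FP.<? d) ×-dec (adjT? a b c d ×-dec inC? l c d)

  orderedAdjacent : ∀ (a b c d : Fin n) → ℕ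
  orderedAdjacent a b c d = ind (c FP.<? d) * ind (adjT? a b c d)

  pairInCell-indicator : ∀ l → 1 ≤ l → l ≤ m → (a b c d : Fin n) →
    ind (pairInCell? l a b c d) ≡ δ d (c +ₙ l) * orderedAdjacent a b c d + δ c (d +ₙ l) * orderedAdjacent a b c d
  pairInCell-indicator l 1≤l l≤m a b c d = begin
    ind (pairInCell? l a b c d)
      ≡⟨ ind-× (c FP.<? d) (adjT? a b c d ×-dec inC? l c d) ⟩
    ind (c FP.<? d) * ind (adjT? a b c d ×-dec inC? l c d)
      ≡⟨ cong (ind (c FP.<? d) *_) (trans (ind-× (adjT? a b c d) (inC? l c d))
                                          (cong (ind (adjT? a b c d) *_) (inC-indicator l 1≤l l≤m c d))) ⟩
    ind (c FP.<? d) * (ind (adjT? a b c d) * (δ d (c +ₙ l) + δ c (d +ₙ l)))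
      ≡⟨ distribute (ind (c FP.<? d)) (ind (adjT? a b c d)) (δ d (c +ₙ l)) (δ c (d +ₙ l)) ⟩
    δ d (c +ₙ l) * orderedAdjacent a b c d + δ c (d +ₙ l) * orderedAdjacent a b c d ∎
    where
    distribute : ∀ L F x y → L * (F * (x + y)) ≡ x * (L * F) + y * (L * F)
    distribute = solve-∀

  -- the pair {c , c + l} is counted in exactly one of its two orders
  bothOrders : ∀ l → 1 ≤ l → l ≤ m → (a b c : Fin n) →
    orderedAdjacent a b c (c +ₙ l) + orderedAdjacent a b (c +ₙ l) c ≡ ind (adjT? a b c (c +ₙ l))
  bothOrders l 1≤l l≤m a b c = begin
    L₁ * F + ind ((c +ₙ l) FP.<? c) * ind (adjT? a b (c +ₙ l) c)
      ≡⟨ cong (λ x → L₁ * F + ind ((c +ₙ l) FP.<? c) * x) (sym (adjacency-swapʳ a b c (c +ₙ l))) ⟩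
    L₁ * F + ind ((c +ₙ l) FP.<? c) * F
      ≡⟨ sym (*-distribʳ-+ F L₁ _) ⟩
    (L₁ + ind ((c +ₙ l) FP.<? c)) * F
      ≡⟨ cong (_* F) (ordered c (c +ₙ l) (λ c≡ → +ₙ-no-fixpoint c 1≤l (≤m⇒<n l≤m) (sym c≡))) ⟩
    1 * F
      ≡⟨ *-identityˡ F ⟩
    F ∎
    where
    L₁ F : ℕ
    L₁ = ind (c FP.<? (c +ₙ l))
    F = ind (adjT? a b c (c +ₙ l))

  -- the neighbours of {a , b} in C_l, each counted once via its point c
  -- with other point c + l
  neighboursInCell : ∀ l → 1 ≤ l → l ≤ m → (a b : Fin n) →
                     nbrsIn l a b ≡ sumFin (λ c → ind (adjT? a b c (c +ₙ l)))
  neighboursInCell l 1≤l l≤m a b = begin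
    nbrsIn l a b
      ≡⟨ sum-cong (λ c → count≡sum _ (pairInCell? l a b c)) ⟩
    sumFin (λ c → sumFin (λ d → ind (pairInCell? l a b c d)))
      ≡⟨ sum-cong (λ c → sum-cong (pairInCell-indicator l 1≤l l≤m a b c)) ⟩
    sumFin (λ c → sumFin (λ d → δ d (c +ₙ l) * G c d + δ c (d +ₙ l) * G c d))
      ≡⟨ trans (sum-cong (λ c → sum-+ (λ d → δ d (c +ₙ l) * G c d) (λ d → δ c (d +ₙ l) * G c d)))
               (sum-+ (λ c → sumFin (λ d → δ d (c +ₙ l) * G c d)) (λ c → sumFin (λ d → δ c (d +ₙ l) * G c d))) ⟩
    sumFin (λ c → sumFin (λ d → δ d (c +ₙ l) * G c d)) + sumFin (λ c → sumFin (λ d → δ c (d +ₙ l) * G c d))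
      ≡⟨ cong₂ _+_ (sum-cong (λ c → δ-sift (c +ₙ l) (G c)))
                   (trans (sum-swap (λ c d → δ c (d +ₙ l) * G c d))
                          (sum-cong (λ d → δ-sift (d +ₙ l) (λ c → G c d)))) ⟩
    sumFin (λ c → G c (c +ₙ l)) + sumFin (λ c → G (c +ₙ l) c)
      ≡⟨ sym (sum-+ (λ c → G c (c +ₙ l)) (λ c → G (c +ₙ l) c)) ⟩
    sumFin (λ c → G c (c +ₙ l) + G (c +ₙ l) c)
      ≡⟨ sum-cong (bothOrders l 1≤l l≤m a b) ⟩
    sumFin (λ c → ind (adjT? a b c (c +ₙ l))) ∎
    where
    G : Fin n → Fin n → ℕ
    G = orderedAdjacent a b

  cellOfGap : ∀ g → 1 ≤ g → g ≤ m → Σ (Fin m) (λ c → gap c ≡ g)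
  cellOfGap (suc g) _ g<m = fromℕ< g<m , cong suc (toℕ-fromℕ< g<m)

  quotient : ∀ c e → sumFin (λ ℓ → adj (c , ℓ) e) ≡ Qmat (gap (proj₁ e)) (gap c)
  quotient c e with gap (proj₁ e) ℕ.≟ gap c
  ... | yes same = +-cancelʳ-≡ 2 _ 2 (trans (cong (λ x → sumFin (λ ℓ → adj (c , ℓ) e) + 2 * x)
                                                   (sym (trans (cong (δ c) sameCell) (δ-refl c))))
                                            (cellAdjacency c e))
    where
    sameCell : proj₁ e ≡ c
    sameCell = toℕ-injective (suc-injective same)
  ... | no different = trans (sym (+-identityʳ _))
                             (trans (cong (λ x → sumFin (λ ℓ → adj (c , ℓ) e) + 2 * x)
                                          (sym (δ-≢ (λ c≡ → different (cong gap (sym c≡))))))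
                                    (cellAdjacency c e))

  equitable : ∀ g l → 1 ≤ g → g ≤ m → 1 ≤ l → l ≤ m →
              ∀ (a b : Fin n) → IsVert a b → InC g a b → nbrsIn l a b ≡ Qmat g l
  equitable g l 1≤g g≤m 1≤l l≤m a b _ (ℓ , a,b≡) with cellOfGap g 1≤g g≤m | cellOfGap l 1≤l l≤m
  ... | cg , refl | cl , refl = trans (neighboursInCell (gap cl) 1≤l l≤m a b) (byOrientation a,b≡)
    where
    e : Edge
    e = (cg , ℓ)
    viaEdge : sumFin (λ c → ind (adjT? (end₁ e) (end₂ e) c (c +ₙ gap cl))) ≡ Qmat (gap cg) (gap cl)
    viaEdge = trans (sum-cong (λ c → adj-sym e (cl , c))) (quotient cl e)
    byOrientation : SameSet a b ℓ (ℓ +ₙ gap cg) →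
                    sumFin (λ c → ind (adjT? a b c (c +ₙ gap cl))) ≡ Qmat (gap cg) (gap cl)
    byOrientation (inj₁ (refl , refl)) = viaEdge
    byOrientation (inj₂ (refl , refl)) =
      trans (sum-cong (λ c → adjacency-swapˡ (end₂ e) (end₁ e) c (c +ₙ gap cl))) viaEdge

  isEquitable : IsEquitablePartitionT m
  isEquitable = nonempty , cover , disjoint , equitable

-- A balanced colouring of Fin (jm + 1) with m ≥ 1 colours: the arrow
-- x → y gets the colour  (position of x among the points ≠ y) mod m.
module _ (j m₁ : ℕ) where

  private
    m r : ℕ
    m = suc m₁
    r = j * m

  -- the colour of the arrow x → y (the diagonal gets an arbitrary colour)
  colourOf : Fin (suc r) → Fin (suc r) → Fin m
  colourOf x y with y FP.≟ x
  ... | yes _   = F.zero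
  ... | no y≢x  = proj₂ (remQuot {j} m (punchOut y≢x))

  colourOf-off : ∀ {x y} (y≢x : y ≢ x) → colourOf x y ≡ proj₂ (remQuot {j} m (punchOut y≢x))
  colourOf-off {x} {y} y≢x with y FP.≟ x
  ... | yes y≡x = ⊥-elim (y≢x y≡x)
  ... | no y≢x′ = cong (λ e → proj₂ (remQuot {j} m e)) (punchOut-cong y refl)

  balancedColouring : BalancedColouring (suc r) m j
  balancedColouring = record { colour = colourOf ; balanced = balanced }
    where
    balanced : ∀ y c → sumFin (λ x → arrow colourOf x y c) ≡ j
    balanced y c = begin
      sumFin (λ x → arrow colourOf x y c)
        ≡⟨ sum-punch y (λ x → arrow colourOf x y c) ⟩
      arrow colourOf y y c + sumFin (λ e → arrow colourOf (punchIn y e) y c)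
        ≡⟨ cong₂ _+_ (cong (λ d → (1 ∸ d) * δ (colourOf y y) c) (δ-refl y)) (sum-cong offDiagonal) ⟩
      sumFin (λ e → δ (proj₂ (remQuot {j} m e)) c)
        ≡⟨ sum-remQuot {j} {m} (λ a → δ (proj₂ a) c) ⟩
      sumFin {j} (λ _ → sumFin (λ b → δ b c))
        ≡⟨ trans (sum-cong {j} (λ _ → δ-sum c)) (trans (sum-const {j} 1) (*-identityʳ j)) ⟩
      j ∎
      where
      offDiagonal : ∀ e → arrow colourOf (punchIn y e) y c ≡ δ (proj₂ (remQuot {j} m e)) c
      offDiagonal e = begin
        (1 ∸ δ (punchIn y e) y) * δ (colourOf (punchIn y e) y) c
          ≡⟨ cong (λ d → (1 ∸ d) * δ (colourOf (punchIn y e) y) c) (δ-≢ (punchInᵢ≢i y e)) ⟩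
        1 * δ (colourOf (punchIn y e) y) c
          ≡⟨ *-identityˡ _ ⟩
        δ (colourOf (punchIn y e) y) c
          ≡⟨ cong (λ a → δ a c) (trans (colourOf-off (punchInᵢ≢i y e ∘ sym))
                                       (cong (λ e′ → proj₂ (remQuot {j} m e′)) (punchOut-punchIn y))) ⟩
        δ (proj₂ (remQuot {j} m e)) c ∎

ExistsDSRG-cong : ∀ {N K T L M N′ K′ T′ L′ M′} → N ≡ N′ → K ≡ K′ → T ≡ T′ → L ≡ L′ → M ≡ M′ →
                  ExistsDSRG N K T L M → ExistsDSRG N′ K′ T′ L′ M′
ExistsDSRG-cong refl refl refl refl refl dsrg = dsrg

-- bounds needed to cancel the truncated subtractions in the parameters
2≤4m : ∀ {m} → 1 ≤ m → 2 ≤ 4 * m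
2≤4m 1≤m = ≤-trans (s≤s (s≤s z≤n)) (*-monoʳ-≤ 4 1≤m)

1≤2m : ∀ {m} → 1 ≤ m → 1 ≤ 2 * m
1≤2m 1≤m = ≤-trans (s≤s z≤n) (*-monoʳ-≤ 2 1≤m)

liftedTriangular : ∀ m j → 1 ≤ m →
  let n = suc (2 * m) in
  ExistsDSRG (m * n * suc (j * m)) ((4 * m ∸ 2) + n * (j * m)) ((4 * m ∸ 2) + n * j)
             ((2 * m ∸ 1) + n * j) (4 + n * j)
liftedTriangular m@(suc m₁) j 1≤m =
  Lift.liftedMat isSRG cellsEquitable ownCell (balancedColouring j m₁) ,
  Lift.isDSRG isSRG cellsEquitable ownCell (balancedColouring j m₁)
  where
  open Triangular m
  ownCell : (4 * m ∸ 2) + 2 ≡ (2 * m ∸ 1) + n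
  ownCell = begin
    (4 * m ∸ 2) + 2           ≡⟨ m∸n+n≡m (2≤4m 1≤m) ⟩
    4 * m                     ≡⟨ double m ⟩
    2 * m + 2 * m             ≡⟨ cong (_+ 2 * m) (sym (m∸n+n≡m (1≤2m 1≤m))) ⟩
    (2 * m ∸ 1) + 1 + 2 * m   ≡⟨ shuffle (2 * m ∸ 1) m ⟩
    (2 * m ∸ 1) + n           ∎
    where
    double : ∀ m → 4 * m ≡ 2 * m + 2 * m
    double = solve-∀
    shuffle : ∀ d m → d + 1 + 2 * m ≡ d + suc (2 * m)
    shuffle = solve-∀

∸-shuffle : ∀ {x y c z} → c ≤ y → x ≡ z → (y ∸ c) + x ≡ z + y ∸ c
∸-shuffle {x} {y} {c} {z} c≤y x≡z = begin
  (y ∸ c) + x     ≡⟨ +-comm (y ∸ c) x ⟩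
  x + (y ∸ c)     ≡⟨ cong (_+ (y ∸ c)) x≡z ⟩
  z + (y ∸ c)     ≡⟨ sym (+-∸-assoc z c≤y) ⟩
  z + y ∸ c       ∎

mainTheorem14 : (m j : ℕ) → 2 ≤ m → 1 ≤ j →
    IsEquitablePartitionT m
    × ExistsDSRG (m * (2 * m + 1) * (j * m + 1))
                 (j * m * (2 * m + 1) + 4 * m ∸ 2)
                 (j * (2 * m + 1) + 4 * m ∸ 2)
                 (j * (2 * m + 1) + 2 * m ∸ 1)
                 (j * (2 * m + 1) + 4)
mainTheorem14 m j 2≤m _ =
  Partition.isEquitable m ,
  ExistsDSRG-cong (size m j) (∸-shuffle (2≤4m 1≤m) (layers m j)) (∸-shuffle (2≤4m 1≤m) (layer m j))
                  (∸-shuffle (1≤2m 1≤m) (layer m j)) (trans (+-comm 4 _) (cong (_+ 4) (layer m j)))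
                  (liftedTriangular m j 1≤m)
  where
  1≤m : 1 ≤ m
  1≤m = ≤-trans (s≤s z≤n) 2≤m
  size : ∀ m j → m * suc (2 * m) * suc (j * m) ≡ m * (2 * m + 1) * (j * m + 1)
  size = solve-∀
  layers : ∀ m j → suc (2 * m) * (j * m) ≡ j * m * (2 * m + 1)
  layers = solve-∀
  layer : ∀ m j → suc (2 * m) * j ≡ j * (2 * m + 1)
  layer = solve-∀
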